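{- Suppose $\mathrm{type}$ is a type attribution for $h_n^3$ satisfying rules (R1) and (R2) below. Let $n\ge1$, $0\le j\le\lfloor 3n/2\rfloor$, and let $T\in\mathrm{SSYT}((3n-j,j),(n,n,n))$ be such that $k_{2,2}(T)=\lfloor k_{3,2}(T)/2\rfloor$, where $k_{i,2}(T)$ is the number of entries $i$ in the second row of $T$. Then $\mathrm{type}(T)=t_{123}$ if $j\equiv0\pmod 6$, $\mathrm{type}(T)=t_{12|3}$ if $j\equiv 1\pmod 6$, $\mathrm{type}(T)=t_{1|2|3}$ if $j\equiv3\pmod 6$, and $\mathrm{type}(T)=t_{13|2}$ if $j\equiv 4\pmod 6$.
   Context: $\mathrm{SSYT}(\mu,(n,n,n))$: semistandard tableaux (rows weakly increasing, columns strictly increasing) of shape $\mu$ with each of $1,2,3$ occurring $n$ times. $\mathrm{SYT}_3=\{t_{123},t_{12|3},t_{13|2},t_{1|2|3}\}$ are the standard tableaux with 3 cells ($t_{123}$ one row; $t_{12|3}$ rows $\{1,2\},\{3\}$; $t_{13|2}$ rows $\{1,3\},\{2\}$; $t_{1|2|3}$ one column). A type attribution for $h_n^3$ is a function $\mathrm{type}$ from $\bigcup_{n\ge1}\bigcup_{\mu\vdash 3n}\mathrm{SSYT}(\mu,(n,n,n))$ to $\mathrm{SYT}_3$ such that for all $n\ge1$, $\mu\vdash 3n$ and $t\in\mathrm{SYT}_3$, $\#\{T\in\mathrm{SSYT}(\mu,(n,n,n)):\mathrm{type}(T)=t\}=\langle s_\mu, s_{\mathrm{shape}(t)}[h_n]\rangle$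 (Schur functions $s$, $h_n=s_{(n)}$, plethysm $f[g]$, Hall inner product). Rule (R1): $\mathrm{type}(T)\in\{t_{123},t_{12|3}\}$ if the number of entries $2$ in the second row of $T$ is even, and $\mathrm{type}(T)\in\{t_{13|2},t_{1|2|3}\}$ if it is odd. Rule (R2): for every such $T$ of shape $\mu$, $\mathrm{type}(T\vee[123])=\mathrm{type}(T)$, where $T\vee[123]$ is the tableau of shape $(\mu_1+3,\mu_2,\mu_3,\dots)$ and content $(n+1,n+1,n+1)$ obtained by adding entries $1,2,3$ to the first row of $T$ and sorting that row. -}

module Defs where

open import Data.Bool using (Bool; true; false; _∧_; _∨_; not; if_then_else_)
open import Data.Nat using (ℕ; zero; suc; _+_; _*_; _∸_; _≡ᵇ_; _<ᵇ_; _≤ᵇ_; _≤_)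
open import Data.List using (List; []; _∷_; map; length; concat; concatMap; zipWith; replicate; upTo; filterᵇ; foldr)
open import Data.Nat.ListAction using (sum)
open import Relation.Binary.PropositionalEquality using (_≡_)
open import Data.Sum using (_⊎_)
open import Data.Product using (_×_)
open import Data.Integer using (ℤ; +_; -_) renaming (_+_ to _+ℤ_; _*_ to _*ℤ_)

all : {A : Set} → (A → Bool) → List A → Bool
all p [] = true
all p (x ∷ xs) = p x ∧ all p xs

eqList : List ℕ → List ℕ → Bool
eqList [] [] = true
eqList (x ∷ xs) (y ∷ ys) = (x ≡ᵇ y) ∧ eqList xs ys
eqList _ _ = false

isEven : ℕ → Bool
isEven zero = true
isEven (suc n) = not (isEven n)

words : {A : Set} → List A → ℕ → List (List A)
words xs zero = [] ∷ []
words xs (suc l) = concatMap (λ x → map (x ∷_) (words xs l)) xs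

-- Tableaux are lists of rows (top row first, English convention).

fillings : {A : Set} → List A → List ℕ → List (List (List A))
fillings xs [] = [] ∷ []
fillings xs (l ∷ μ) = concatMap (λ r → map (r ∷_) (fillings xs μ)) (words xs l)

rowWeak : {A : Set} → (A → A → Bool) → List A → Bool
rowWeak lt (a ∷ b ∷ r) = not (lt b a) ∧ rowWeak lt (b ∷ r)
rowWeak lt _ = true

colStrict : {A : Set} → (A → A → Bool) → List A → List A → Bool
colStrict lt (a ∷ u) (b ∷ l) = lt a b ∧ colStrict lt u l
colStrict lt [] (b ∷ l) = false
colStrict lt _ [] = true

colsStrict : {A : Set} → (A → A → Bool) → List (List A) → Bool
colsStrict lt (r ∷ r' ∷ T) = colStrict lt r r' ∧ colsStrict lt (r' ∷ T)
colsStrict lt _ = true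

isSemistandard : {A : Set} → (A → A → Bool) → List (List A) → Bool
isSemistandard lt T = all (rowWeak lt) T ∧ colsStrict lt T

shapeOf : {A : Set} → List (List A) → List ℕ
shapeOf T = map length T

decreasing : List ℕ → Bool
decreasing (a ∷ b ∷ μ) = (b ≤ᵇ a) ∧ decreasing (b ∷ μ)
decreasing _ = true

isPartition : List ℕ → Bool
isPartition μ = all (λ x → 1 ≤ᵇ x) μ ∧ decreasing μ

countIn : ℕ → List ℕ → ℕ
countIn i xs = length (filterᵇ (i ≡ᵇ_) xs)

isSSYT3 : List ℕ → ℕ → List (List ℕ) → Bool
isSSYT3 μ n T =
  eqList (shapeOf T) μ
  ∧ all (all (λ x → (1 ≤ᵇ x) ∧ (x ≤ᵇ 3))) T
  ∧ isSemistandard _<ᵇ_ T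
  ∧ (countIn 1 (concat T) ≡ᵇ n)
  ∧ (countIn 2 (concat T) ≡ᵇ n)
  ∧ (countIn 3 (concat T) ≡ᵇ n)

SSYTs : List ℕ → ℕ → List (List (List ℕ))
SSYTs μ n = filterᵇ (isSSYT3 μ n) (fillings (1 ∷ 2 ∷ 3 ∷ []) μ)

data SYT3 : Set where
  t123 t12∣3 t13∣2 t1∣2∣3 : SYT3

_==ᵗ_ : SYT3 → SYT3 → Bool
t123 ==ᵗ t123 = true
t12∣3 ==ᵗ t12∣3 = true
t13∣2 ==ᵗ t13∣2 = true
t1∣2∣3 ==ᵗ t1∣2∣3 = true
_ ==ᵗ _ = false

shapeSYT : SYT3 → List ℕ
shapeSYT t123 = 3 ∷ []
shapeSYT t12∣3 = 2 ∷ 1 ∷ []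
shapeSYT t13∣2 = 2 ∷ 1 ∷ []
shapeSYT t1∣2∣3 = 1 ∷ 1 ∷ 1 ∷ []

-- Work in N = length μ variables x_0..x_{N-1}.  Monomials of degree n
-- are exponent vectors (compositions of n with N parts), totally
-- ordered lexicographically.  s_ν[h_n](x) = s_ν evaluated at all these
-- monomials, i.e. the sum over SSYT P of shape ν with monomial entries
-- of the product of the entries.

comps : ℕ → ℕ → List (List ℕ)
comps n zero = if n ≡ᵇ 0 then [] ∷ [] else []
comps n (suc N) = concatMap (λ k → map (k ∷_) (comps (n ∸ k) N)) (upTo (suc n))

lexLt : List ℕ → List ℕ → Bool
lexLt (x ∷ xs) (y ∷ ys) = (x <ᵇ y) ∨ ((x ≡ᵇ y) ∧ lexLt xs ys)
lexLt _ _ = false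

vecSum : ℕ → List (List (List ℕ)) → List ℕ
vecSum N P = foldr (zipWith _+_) (replicate N 0) (concat P)

-- [x^α] s_ν[h_n](x_0,…,x_{N-1}) with N = length α
monCoeff : List ℕ → ℕ → List ℕ → ℕ
monCoeff ν n α =
  length (filterᵇ (λ P → isSemistandard lexLt P ∧ eqList (vecSum (length α) P) α)
                  (fillings (comps n (length α)) ν))

insertions : ℕ → List ℕ → List (List ℕ)
insertions x [] = (x ∷ []) ∷ []
insertions x (y ∷ ys) = (x ∷ y ∷ ys) ∷ map (y ∷_) (insertions x ys)

perms : List ℕ → List (List ℕ)
perms [] = [] ∷ []
perms (x ∷ xs) = concatMap (insertions x) (perms xs)

inversions : List ℕ → ℕ
inversions [] = 0
inversions (x ∷ xs) = length (filterᵇ (_<ᵇ x) xs) + inversions xs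

sign : List ℕ → ℤ
sign w = if isEven (inversions w) then + 1 else - (+ 1)

-- exponent μ_i + w(i) - i (i counted from start index) and its validity
shiftOK : ℕ → List ℕ → List ℕ → Bool
shiftOK i (m ∷ μ) (w ∷ ws) = (i ≤ᵇ m + w) ∧ shiftOK (suc i) μ ws
shiftOK i _ _ = true

shifted : ℕ → List ℕ → List ℕ → List ℕ
shifted i (m ∷ μ) (w ∷ ws) = (m + w ∸ i) ∷ shifted (suc i) μ ws
shifted i _ _ = []

sumℤ : List ℤ → ℤ
sumℤ = foldr _+ℤ_ (+ 0)

-- ⟨ s_μ , f ⟩ = [x^{μ+δ}] (a_δ · f) = Σ_w sgn(w) [x^{μ+δ-w(δ)}] f,
-- with f = s_ν[h_n] in N = length μ variables.
pleth : List ℕ → ℕ → List ℕ → ℤ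
pleth ν n μ = sumℤ (map term (perms (upTo (length μ))))
  where
  term : List ℕ → ℤ
  term w = if shiftOK 0 μ w then sign w *ℤ (+ monCoeff ν n (shifted 0 μ w)) else + 0

-- type attribution for h_n^3 (type is given on all row-lists; only its
-- values on semistandard tableaux of content (n,n,n) matter)
IsTypeAttribution : (List (List ℕ) → SYT3) → Set
IsTypeAttribution type =
  ∀ n → 1 ≤ n → ∀ μ → isPartition μ ≡ true → sum μ ≡ 3 * n →
  ∀ t → + length (filterᵇ (λ T → type T ==ᵗ t) (SSYTs μ n)) ≡ pleth (shapeSYT t) n μ

secondRow : List (List ℕ) → List ℕ
secondRow (_ ∷ r ∷ _) = r
secondRow _ = []

k₂ : ℕ → List (List ℕ) → ℕ
k₂ i T = countIn i (secondRow T)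

IsSSYT : List ℕ → ℕ → List (List ℕ) → Set
IsSSYT μ n T = (1 ≤ n) × (isPartition μ ≡ true) × (sum μ ≡ 3 * n) × (isSSYT3 μ n T ≡ true)

RuleR1 : (List (List ℕ) → SYT3) → Set
RuleR1 type = ∀ n μ T → IsSSYT μ n T →
  (isEven (k₂ 2 T) ≡ true → (type T ≡ t123) ⊎ (type T ≡ t12∣3)) ×
  (isEven (k₂ 2 T) ≡ false → (type T ≡ t13∣2) ⊎ (type T ≡ t1∣2∣3))

insertRow : ℕ → List ℕ → List ℕ
insertRow x [] = x ∷ []
insertRow x (y ∷ ys) = if x ≤ᵇ y then x ∷ y ∷ ys else y ∷ insertRow x ys

join123 : List (List ℕ) → List (List ℕ)
join123 [] = (1 ∷ 2 ∷ 3 ∷ []) ∷ []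
join123 (r ∷ T) = insertRow 3 (insertRow 2 (insertRow 1 r)) ∷ T

RuleR2 : (List (List ℕ) → SYT3) → Set
RuleR2 type = ∀ n μ T → IsSSYT μ n T → type (join123 T) ≡ type T

twoRow : ℕ → ℕ → List ℕ
twoRow a zero = a ∷ []
twoRow a (suc b) = a ∷ suc b ∷ []

-- Write T = [1ⁿ 2ˣ 3ʸ ; 2ᵇ 3ᶜ]. The hypothesis says b = ⌊c/2⌋, so c = 2b + e with e ∈ {0, 1},
-- j = 3b + e, and j mod 6 records e and the parity of b. Rule R2 removes y copies of [123],
-- leaving the tableau T₀ = [1ᶜ 2ᶜ⁻ᵇ ; 2ᵇ 3ᶜ] of content (c, c, c). If e = 0, T₀ is the only
-- tableau of its shape and content; as t₁₂|₃ and t₁₃|₂ have the same shape they are attributed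
-- equally often, so T₀ has neither type, and R1 (k₂₂ = b) chooses between t₁₂₃ and t₁|₂|₃.
-- If e = 1 there is a second tableau T₁ with k₂₂ = b + 1, and by the two-row bialternant formula
-- ⟨s_(3b+2,3b+1), h₃[h_(2b+1)]⟩ = G(3b+2) − G(3b+3), where G(s) counts triples
-- 0 ≤ k₁ ≤ k₂ ≤ k₃ ≤ 2b+1 of sum s. Reflecting the middle part, k₂ ↦ 2b+2 − k₂, shows that
-- these counts agree, so neither tableau has type t₁₂₃, and R1 together with the balance of
-- t₁₂|₃ and t₁₃|₂ determines type T₀. When j = 0, R2 reduces T to [123], whose type is t₁₂₃.

module Submission where

open import Defs
open import Data.Bool using (Bool; true; false; T; _∧_; not; if_then_else_)
open import Data.Bool.Properties using (if-float; not-involutive; T-≡; T-∧; ∧-identityʳ; ∧-zeroʳ; ∧-conicalˡ; ∧-conicalʳ)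
open import Data.Empty using (⊥-elim)
import Data.Integer as ℤ
import Data.Integer.Properties as ℤₚ
open import Data.List using (List; []; _∷_; _++_; map; length; concat; concatMap; filterᵇ; applyUpTo; upTo; replicate)
open import Data.List.Properties
  using (map-++; map-cong; map-∘; filter-++; length-++; ++-identityʳ; ∷-injectiveˡ; ∷-injectiveʳ; ≡-dec)
open import Data.Nat
open import Data.Nat.DivMod using (m<n⇒m%n≡m; [m+n]%n≡m%n; m%n<n; m≡m%n+[m/n]*n)
open import Data.Nat.ListAction using (sum)
open import Data.Nat.ListAction.Properties using (sum-++)
open import Data.Nat.Properties
open import Algebra.Properties.CommutativeSemigroup +-commutativeSemigroup using (interchange)
open import Data.Nat.Tactic.RingSolver using (solve-∀; solve)
open import Data.Product using (_×_; _,_; proj₁; proj₂; ∃-syntax)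
open import Data.Sum using (_⊎_; inj₁; inj₂; [_,_]′)
open import Data.Unit using (tt)
open import Function using (_∘_; _⇔_; mk⇔; Equivalence)
open import Function.Properties.Equivalence using () renaming (trans to ⇔-trans)
open import Relation.Binary.Definitions using (DecidableEquality)
open import Relation.Binary.PropositionalEquality
open import Relation.Nullary using (¬_; yes; no)
open import Relation.Nullary.Decidable using (T?; ⌊_⌋)

open Equivalence using (to; from)

indicator : Bool → ℕ
indicator true = 1
indicator false = 0

indicator-true : ∀ {p} → T p → indicator p ≡ 1
indicator-true {true} _ = refl

indicator-false : ∀ {p} → ¬ T p → indicator p ≡ 0
indicator-false {false} _ = refl
indicator-false {true} ¬p = ⊥-elim (¬p tt)

T-≤ᵇ : ∀ {m n} → T (m ≤ᵇ n) ⇔ m ≤ n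
T-≤ᵇ {m} {n} = mk⇔ (≤ᵇ⇒≤ m n) ≤⇒≤ᵇ

T-≡ᵇ : ∀ {m n} → T (m ≡ᵇ n) ⇔ m ≡ n
T-≡ᵇ {m} {n} = mk⇔ (≡ᵇ⇒≡ m n) (≡⇒≡ᵇ m n)

not-<ᵇ : ∀ m n → not (n <ᵇ m) ≡ (m ≤ᵇ n)
not-<ᵇ zero n = refl
not-<ᵇ (suc m) zero = refl
not-<ᵇ (suc zero) (suc n) = refl
not-<ᵇ (suc (suc m)) (suc n) = not-<ᵇ (suc m) n

T-not-<ᵇ : ∀ {m n} → T (not (n <ᵇ m)) ⇔ m ≤ n
T-not-<ᵇ {m} {n} = mk⇔ (to T-≤ᵇ ∘ subst T (not-<ᵇ m n)) (subst T (sym (not-<ᵇ m n)) ∘ from T-≤ᵇ)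

<ᵇ-irrefl : ∀ n → (n <ᵇ n) ≡ false
<ᵇ-irrefl zero = refl
<ᵇ-irrefl (suc n) = <ᵇ-irrefl n

∧-absorbed : ∀ {a b} → (T a → T b) → a ∧ b ≡ a
∧-absorbed {false} _ = refl
∧-absorbed {true} {true} _ = refl
∧-absorbed {true} {false} a⇒b = ⊥-elim (a⇒b tt)

∧-true⇔ : ∀ {a b} → a ∧ b ≡ true ⇔ (a ≡ true × b ≡ true)
∧-true⇔ {a} {b} = mk⇔ (λ h → ∧-conicalˡ a b h , ∧-conicalʳ a b h) (λ (a≡true , b≡true) → cong₂ _∧_ a≡true b≡true)

≡ᵇ-true⇔ : ∀ {m n} → (m ≡ᵇ n) ≡ true ⇔ m ≡ n
≡ᵇ-true⇔ {m} {n} = mk⇔ (≡ᵇ⇒≡ m n ∘ from T-≡) (to T-≡ ∘ ≡⇒≡ᵇ m n)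

≤⇒≤ᵇ-true : ∀ {m n} → m ≤ n → (m ≤ᵇ n) ≡ true
≤⇒≤ᵇ-true = to T-≡ ∘ ≤⇒≤ᵇ

eqList-true⇔ : ∀ {xs ys} → eqList xs ys ≡ true ⇔ xs ≡ ys
eqList-true⇔ = mk⇔ sound complete
  where
  sound : ∀ {xs ys} → eqList xs ys ≡ true → xs ≡ ys
  sound {[]} {[]} _ = refl
  sound {x ∷ xs} {y ∷ ys} h = let (x≡y , xs≡ys) = to ∧-true⇔ h in cong₂ _∷_ (to ≡ᵇ-true⇔ x≡y) (sound xs≡ys)
  complete : ∀ {xs ys} → xs ≡ ys → eqList xs ys ≡ true
  complete {[]} refl = refl
  complete {x ∷ xs} refl = cong₂ _∧_ (from (≡ᵇ-true⇔ {x}) refl) (complete {xs} refl)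

∑< : ℕ → (ℕ → ℕ) → ℕ
∑< zero f = 0
∑< (suc n) f = f 0 + ∑< n (f ∘ suc)

syntax ∑< n (λ i → e) = ∑[ i < n ] e

∑-cong : ∀ n {f g : ℕ → ℕ} → (∀ i → i < n → f i ≡ g i) → ∑< n f ≡ ∑< n g
∑-cong zero f≡g = refl
∑-cong (suc n) f≡g = cong₂ _+_ (f≡g 0 z<s) (∑-cong n (λ i i<n → f≡g (suc i) (s<s i<n)))

∑-zero : ∀ n {f : ℕ → ℕ} → (∀ i → i < n → f i ≡ 0) → ∑< n f ≡ 0
∑-zero zero f≡0 = refl
∑-zero (suc n) f≡0 = cong₂ _+_ (f≡0 0 z<s) (∑-zero n (λ i i<n → f≡0 (suc i) (s<s i<n)))

∑-single : ∀ n {f : ℕ → ℕ} t → t < n → (∀ i → i < n → i ≢ t → f i ≡ 0) → ∑< n f ≡ f t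
∑-single (suc n) zero _ f≡0 =
  trans (cong (_ +_) (∑-zero n (λ i i<n → f≡0 (suc i) (s<s i<n) λ ()))) (+-identityʳ _)
∑-single (suc n) (suc t) (s<s t<n) f≡0 =
  cong₂ _+_ (f≡0 0 z<s λ ()) (∑-single n t t<n (λ i i<n i≢t → f≡0 (suc i) (s<s i<n) (i≢t ∘ suc-injective)))

∑-distrib-+ : ∀ n (f g : ℕ → ℕ) → ∑[ i < n ] (f i + g i) ≡ ∑< n f + ∑< n g
∑-distrib-+ zero f g = refl
∑-distrib-+ (suc n) f g =
  trans (cong (f 0 + g 0 +_) (∑-distrib-+ n (f ∘ suc) (g ∘ suc))) (interchange (f 0) (g 0) _ _)

∑-comm : ∀ m n (f : ℕ → ℕ → ℕ) → ∑[ i < m ] ∑[ j < n ] f i j ≡ ∑[ j < n ] ∑[ i < m ] f i j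
∑-comm zero n f = sym (∑-zero n (λ _ _ → refl))
∑-comm (suc m) n f = trans (cong (∑< n (f 0) +_) (∑-comm m n (f ∘ suc)))
                           (sym (∑-distrib-+ n (f 0) (λ j → ∑[ i < m ] f (suc i) j)))

∑-snoc : ∀ n (f : ℕ → ℕ) → ∑< (suc n) f ≡ ∑< n f + f n
∑-snoc zero f = +-identityʳ (f 0)
∑-snoc (suc n) f = trans (cong (f 0 +_) (∑-snoc n (f ∘ suc))) (sym (+-assoc (f 0) _ _))

∑-reverse : ∀ n (f : ℕ → ℕ) → ∑< n f ≡ ∑[ i < n ] f (n ∸ suc i)
∑-reverse zero f = refl
∑-reverse (suc n) f = begin
  ∑< (suc n) f                   ≡⟨ ∑-snoc n f ⟩
  ∑< n f + f n                   ≡⟨ cong (_+ f n) (∑-reverse n f) ⟩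
  ∑[ i < n ] f (n ∸ suc i) + f n ≡⟨ +-comm _ (f n) ⟩
  f n + ∑[ i < n ] f (n ∸ suc i) ∎
  where open ≡-Reasoning

-- Bounding k + f rather than k keeps truncated subtraction out of the hypothesis.
∑-interval : ∀ n lo f g (p : ℕ → Bool) → (∀ k → T (p k) ⇔ (lo ≤ k × k + f ≤ g)) → g < n + f →
             ∑[ k < n ] indicator (p k) ≡ suc g ∸ f ∸ lo
∑-interval zero lo f g p p⇔ g<f = trans (sym (0∸n≡0 lo)) (cong (_∸ lo) (sym (m≤n⇒m∸n≡0 g<f)))
∑-interval (suc n) zero f g p p⇔ g<n+f = begin
  indicator (p 0) + ∑[ k < n ] indicator (p (suc k)) ≡⟨ cong (indicator (p 0) +_) rest ⟩
  indicator (p 0) + (g ∸ f)                          ≡⟨ first ⟩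
  suc g ∸ f                                          ∎
  where
  open ≡-Reasoning
  shift : ∀ k → T (p (suc k)) ⇔ (0 ≤ k × k + suc f ≤ g)
  shift k = mk⇔ (λ h → z≤n , subst (_≤ g) (sym (+-suc k f)) (proj₂ (to (p⇔ (suc k)) h)))
                (λ (_ , h) → from (p⇔ (suc k)) (z≤n , subst (_≤ g) (+-suc k f) h))
  rest : ∑[ k < n ] indicator (p (suc k)) ≡ g ∸ f
  rest = ∑-interval n 0 (suc f) g (p ∘ suc) shift (subst (g <_) (sym (+-suc n f)) g<n+f)
  first : indicator (p 0) + (g ∸ f) ≡ suc g ∸ f
  first with f ≤? g
  ... | yes f≤g = trans (cong (_+ (g ∸ f)) (indicator-true (from (p⇔ 0) (z≤n , f≤g))))
                        (sym (+-∸-assoc 1 f≤g))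
  ... | no f≰g = trans (cong₂ _+_ (indicator-false (f≰g ∘ proj₂ ∘ to (p⇔ 0)))
                                  (m≤n⇒m∸n≡0 (<⇒≤ (≰⇒> f≰g))))
                       (sym (m≤n⇒m∸n≡0 (≰⇒> f≰g)))
∑-interval (suc n) (suc lo) f g p p⇔ g<n+f = begin
  indicator (p 0) + ∑[ k < n ] indicator (p (suc k)) ≡⟨ cong₂ _+_ (indicator-false (1+lo≰0 ∘ proj₁ ∘ to (p⇔ 0))) rest ⟩
  g ∸ f ∸ lo                                         ≡⟨ ∸-+-assoc g f lo ⟩
  g ∸ (f + lo)                                       ≡⟨ cong (suc g ∸_) (sym (+-suc f lo)) ⟩
  suc g ∸ (f + suc lo)                               ≡⟨ sym (∸-+-assoc (suc g) f (suc lo)) ⟩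
  suc g ∸ f ∸ suc lo                                 ∎
  where
  open ≡-Reasoning
  1+lo≰0 : ¬ (suc lo ≤ 0)
  1+lo≰0 ()
  shift : ∀ k → T (p (suc k)) ⇔ (lo ≤ k × k + suc f ≤ g)
  shift k = mk⇔ (λ h → let (lo≤ , ≤g) = to (p⇔ (suc k)) h in s≤s⁻¹ lo≤ , subst (_≤ g) (sym (+-suc k f)) ≤g)
                (λ (lo≤ , ≤g) → from (p⇔ (suc k)) (s≤s lo≤ , subst (_≤ g) (+-suc k f) ≤g))
  rest : ∑[ k < n ] indicator (p (suc k)) ≡ g ∸ f ∸ lo
  rest = ∑-interval n lo (suc f) g (p ∘ suc) shift (subst (g <_) (sym (+-suc n f)) g<n+f)

∑-interval-shift : ∀ n d X (p q : ℕ → Bool) →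
  (∀ k → T (p k) ⇔ (suc d ≤ k × k ≤ suc X)) → (∀ k → T (q k) ⇔ k + d ≤ X) → suc X < n →
  ∑[ k < n ] indicator (p k) ≡ ∑[ k < n ] indicator (q k)
∑-interval-shift n d X p q p⇔ q⇔ X<n =
  trans (∑-interval n (suc d) 0 (suc X) p p⇔′ (subst (suc X <_) (sym (+-identityʳ n)) X<n))
        (sym (∑-interval n 0 d X q q⇔′ (≤-trans (<⇒≤ X<n) (m≤m+n n d))))
  where
  p⇔′ : ∀ k → T (p k) ⇔ (suc d ≤ k × k + 0 ≤ suc X)
  p⇔′ k = mk⇔ (λ h → let (d<k , k≤X) = to (p⇔ k) h in d<k , subst (_≤ suc X) (sym (+-identityʳ k)) k≤X)
              (λ (d<k , k≤X) → from (p⇔ k) (d<k , subst (_≤ suc X) (+-identityʳ k) k≤X))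
  q⇔′ : ∀ k → T (q k) ⇔ (0 ≤ k × k + d ≤ X)
  q⇔′ k = mk⇔ (λ h → z≤n , to (q⇔ k) h) (from (q⇔ k) ∘ proj₂)

length-filterᵇ : ∀ {A : Set} (p : A → Bool) xs → length (filterᵇ p xs) ≡ sum (map (indicator ∘ p) xs)
length-filterᵇ p [] = refl
length-filterᵇ p (x ∷ xs) with p x
... | true = cong suc (length-filterᵇ p xs)
... | false = length-filterᵇ p xs

sum-map-++ : ∀ {A : Set} (f : A → ℕ) xs ys → sum (map f (xs ++ ys)) ≡ sum (map f xs) + sum (map f ys)
sum-map-++ f xs ys = trans (cong sum (map-++ f xs ys)) (sum-++ (map f xs) (map f ys))

sum-map-concatMap : ∀ {A B : Set} (f : B → ℕ) (g : A → List B) xs →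
                    sum (map f (concatMap g xs)) ≡ sum (map (λ x → sum (map f (g x))) xs)
sum-map-concatMap f g [] = refl
sum-map-concatMap f g (x ∷ xs) =
  trans (sum-map-++ f (g x) (concatMap g xs)) (cong (sum (map f (g x)) +_) (sum-map-concatMap f g xs))

sum-map-applyUpTo : ∀ {A : Set} (f : A → ℕ) (g : ℕ → A) n → sum (map f (applyUpTo g n)) ≡ ∑[ i < n ] f (g i)
sum-map-applyUpTo f g zero = refl
sum-map-applyUpTo f g (suc n) = cong (f (g 0) +_) (sum-map-applyUpTo f (g ∘ suc) n)

sum-map-words : ∀ {A : Set} (f : List A → ℕ) xs l →
                sum (map f (words xs (suc l))) ≡ sum (map (λ x → sum (map (f ∘ (x ∷_)) (words xs l))) xs)
sum-map-words f xs l = trans (sum-map-concatMap f (λ x → map (x ∷_) (words xs l)) xs)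
                             (cong sum (map-cong (λ x → cong sum (sym (map-∘ (words xs l)))) xs))

sum-map-words₃ : ∀ {A : Set} (xs : List A) (g : List A → ℕ) →
  sum (map g (words xs 3)) ≡ sum (map (λ x → sum (map (λ y → sum (map (λ z → g (x ∷ y ∷ z ∷ [])) xs)) xs)) xs)
sum-map-words₃ xs g =
  trans (sum-map-words g xs 2) (cong sum (map-cong (λ x →
  trans (sum-map-words _ xs 1) (cong sum (map-cong (λ y →
  trans (sum-map-words _ xs 0) (cong sum (map-cong (λ z → +-identityʳ _) xs))) xs))) xs))

comp₂ : ℕ → ℕ → List ℕ
comp₂ m k = k ∷ m ∸ k ∷ []

private
  comps-pos : ∀ r k → k < r → comps (r ∸ k) 0 ≡ []
  comps-pos (suc r) zero _ = refl
  comps-pos (suc r) (suc k) (s<s k<r) = comps-pos r k k<r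

sum-map-comps₁ : ∀ r (f : List ℕ → ℕ) → sum (map f (comps r 1)) ≡ f (r ∷ [])
sum-map-comps₁ r f = begin
  sum (map f (comps r 1))
    ≡⟨ sum-map-concatMap f (λ k → map (k ∷_) (comps (r ∸ k) 0)) (upTo (suc r)) ⟩
  sum (map (λ k → sum (map f (map (k ∷_) (comps (r ∸ k) 0)))) (upTo (suc r)))
    ≡⟨ sum-map-applyUpTo _ (λ k → k) (suc r) ⟩
  ∑[ k < suc r ] sum (map f (map (k ∷_) (comps (r ∸ k) 0)))
    ≡⟨ ∑-single (suc r) r ≤-refl others ⟩
  sum (map f (map (r ∷_) (comps (r ∸ r) 0)))
    ≡⟨ cong (λ d → sum (map f (map (r ∷_) (comps d 0)))) (n∸n≡0 r) ⟩
  f (r ∷ []) + 0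
    ≡⟨ +-identityʳ _ ⟩
  f (r ∷ [])
    ∎
  where
  open ≡-Reasoning
  others : ∀ k → k < suc r → k ≢ r → sum (map f (map (k ∷_) (comps (r ∸ k) 0))) ≡ 0
  others k k≤r k≢r rewrite comps-pos r k (≤∧≢⇒< (s≤s⁻¹ k≤r) k≢r) = refl

sum-map-comps₂ : ∀ m (f : List ℕ → ℕ) → sum (map f (comps m 2)) ≡ ∑[ k < suc m ] f (comp₂ m k)
sum-map-comps₂ m f = begin
  sum (map f (comps m 2))
    ≡⟨ sum-map-concatMap f (λ k → map (k ∷_) (comps (m ∸ k) 1)) (upTo (suc m)) ⟩
  sum (map (λ k → sum (map f (map (k ∷_) (comps (m ∸ k) 1)))) (upTo (suc m)))
    ≡⟨ sum-map-applyUpTo _ (λ k → k) (suc m) ⟩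
  ∑[ k < suc m ] sum (map f (map (k ∷_) (comps (m ∸ k) 1)))
    ≡⟨ ∑-cong (suc m) (λ k _ → first-part k) ⟩
  ∑[ k < suc m ] f (comp₂ m k)
    ∎
  where
  open ≡-Reasoning
  first-part : ∀ k → sum (map f (map (k ∷_) (comps (m ∸ k) 1))) ≡ f (comp₂ m k)
  first-part k = trans (cong sum (sym (map-∘ (comps (m ∸ k) 1)))) (sum-map-comps₁ (m ∸ k) (f ∘ (k ∷_)))

sum-map-comps₂³ : ∀ m (g : List ℕ → List ℕ → List ℕ → ℕ) →
  sum (map (λ x → sum (map (λ y → sum (map (λ z → g x y z) (comps m 2))) (comps m 2))) (comps m 2))
  ≡ ∑[ k₁ < suc m ] ∑[ k₂ < suc m ] ∑[ k₃ < suc m ] g (comp₂ m k₁) (comp₂ m k₂) (comp₂ m k₃)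
sum-map-comps₂³ m g =
  trans (sum-map-comps₂ m (λ x → sum (map (λ y → sum (map (g x y) CS)) CS))) (∑-cong (suc m) λ k₁ _ →
  trans (sum-map-comps₂ m (λ y → sum (map (g (comp₂ m k₁) y) CS))) (∑-cong (suc m) λ k₂ _ →
  sum-map-comps₂ m (g (comp₂ m k₁) (comp₂ m k₂))))
  where CS = comps m 2

-- A vanishing coefficient of h₃[h_m]

lexLt-comp₂ : ∀ m a b → lexLt (comp₂ m a) (comp₂ m b) ≡ (a <ᵇ b)
lexLt-comp₂ m a b with a <ᵇ b | a ≡ᵇ b in a≡ᵇb
... | true | _ = refl
... | false | false = refl
... | false | true rewrite ≡ᵇ⇒≡ a b (subst T (sym a≡ᵇb) tt)
                        | <ᵇ-irrefl (m ∸ b) | ∧-zeroʳ (m ∸ b ≡ᵇ m ∸ b) = refl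

rowWeak-comp₂ : ∀ m ks → rowWeak lexLt (map (comp₂ m) ks) ≡ rowWeak _<ᵇ_ ks
rowWeak-comp₂ m [] = refl
rowWeak-comp₂ m (k ∷ []) = refl
rowWeak-comp₂ m (k ∷ k′ ∷ ks) = cong₂ (λ a b → not a ∧ b) (lexLt-comp₂ m k′ k) (rowWeak-comp₂ m (k′ ∷ ks))

triple? : ℕ → ℕ → ℕ → ℕ → Bool
triple? s k₁ k₂ k₃ = rowWeak _<ᵇ_ (k₁ ∷ k₂ ∷ k₃ ∷ []) ∧ (k₁ + k₂ + k₃ ≡ᵇ s)

T-triple? : ∀ s k₁ k₂ k₃ → T (triple? s k₁ k₂ k₃) ⇔ (k₁ ≤ k₂ × k₂ ≤ k₃ × k₁ + k₂ + k₃ ≡ s)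
T-triple? s k₁ k₂ k₃ = mk⇔
  (λ h → let (rw , Σk≡s) = to T-∧ h ; (k₁≤k₂ , rw′) = to T-∧ rw ; (k₂≤k₃ , _) = to T-∧ rw′ in
         to T-not-<ᵇ k₁≤k₂ , to T-not-<ᵇ k₂≤k₃ , to T-≡ᵇ Σk≡s)
  (λ (k₁≤k₂ , k₂≤k₃ , Σk≡s) →
         from T-∧ (from T-∧ (from T-not-<ᵇ k₁≤k₂ , from T-∧ (from T-not-<ᵇ k₂≤k₃ , tt)) , from T-≡ᵇ Σk≡s))

triples : ℕ → ℕ → ℕ
triples m s = ∑[ k₁ < suc m ] ∑[ k₂ < suc m ] ∑[ k₃ < suc m ] indicator (triple? s k₁ k₂ k₃)

complement-sum : ∀ {m s t k₁ k₂ k₃} → k₁ ≤ m → k₂ ≤ m → k₃ ≤ m → s + t ≡ m + m + m →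
                 k₁ + (k₂ + (k₃ + 0)) ≡ s → m ∸ k₁ + (m ∸ k₂ + (m ∸ k₃ + 0)) ≡ t
complement-sum {m} {s} {t} {k₁} {k₂} {k₃} k₁≤m k₂≤m k₃≤m s+t≡3m Σk≡s = +-cancelʳ-≡ s _ _ (begin
  m ∸ k₁ + (m ∸ k₂ + (m ∸ k₃ + 0)) + s                      ≡⟨ cong (_ +_) (sym Σk≡s) ⟩
  m ∸ k₁ + (m ∸ k₂ + (m ∸ k₃ + 0)) + (k₁ + (k₂ + (k₃ + 0))) ≡⟨ regroup (m ∸ k₁) (m ∸ k₂) (m ∸ k₃) k₁ k₂ k₃ ⟩
  (m ∸ k₁ + k₁) + (m ∸ k₂ + k₂) + (m ∸ k₃ + k₃)             ≡⟨ cong₂ _+_ (cong₂ _+_ (m∸n+n≡m k₁≤m) (m∸n+n≡m k₂≤m))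
                                                                         (m∸n+n≡m k₃≤m) ⟩
  m + m + m                                                 ≡⟨ sym s+t≡3m ⟩
  s + t                                                     ≡⟨ +-comm s t ⟩
  t + s                                                     ∎)
  where
  open ≡-Reasoning
  regroup : ∀ a b c d e f → a + (b + (c + 0)) + (d + (e + (f + 0))) ≡ (a + d) + (b + e) + (c + f)
  regroup = solve-∀

monCoeff-3≡triples : ∀ m s t → s + t ≡ m + m + m → monCoeff (3 ∷ []) m (s ∷ t ∷ []) ≡ triples m s
monCoeff-3≡triples m s t s+t≡3m = begin
  monCoeff (3 ∷ []) m (s ∷ t ∷ [])
    ≡⟨ length-filterᵇ F (fillings CS (3 ∷ [])) ⟩
  sum (map (indicator ∘ F) (fillings CS (3 ∷ [])))
    ≡⟨ sum-map-concatMap (indicator ∘ F) (λ r → map (r ∷_) (fillings CS [])) (words CS 3) ⟩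
  sum (map (λ r → indicator (F (r ∷ [])) + 0) (words CS 3))
    ≡⟨ sum-map-words₃ CS _ ⟩
  sum (map (λ x → sum (map (λ y → sum (map (λ z → indicator (F ((x ∷ y ∷ z ∷ []) ∷ [])) + 0) CS)) CS)) CS)
    ≡⟨ sum-map-comps₂³ m _ ⟩
  ∑[ k₁ < suc m ] ∑[ k₂ < suc m ] ∑[ k₃ < suc m ]
    (indicator (F ((comp₂ m k₁ ∷ comp₂ m k₂ ∷ comp₂ m k₃ ∷ []) ∷ [])) + 0)
    ≡⟨ (∑-cong (suc m) λ k₁ k₁≤m → ∑-cong (suc m) λ k₂ k₂≤m → ∑-cong (suc m) λ k₃ k₃≤m →
         trans (+-identityʳ _) (cong indicator (F-comp₂ (s≤s⁻¹ k₁≤m) (s≤s⁻¹ k₂≤m) (s≤s⁻¹ k₃≤m)))) ⟩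
  triples m s
    ∎
  where
  open ≡-Reasoning
  CS = comps m 2
  F : List (List (List ℕ)) → Bool
  F P = isSemistandard lexLt P ∧ eqList (vecSum 2 P) (s ∷ t ∷ [])
  F-comp₂ : ∀ {k₁ k₂ k₃} → k₁ ≤ m → k₂ ≤ m → k₃ ≤ m →
            F (map (comp₂ m) (k₁ ∷ k₂ ∷ k₃ ∷ []) ∷ []) ≡ triple? s k₁ k₂ k₃
  F-comp₂ {k₁} {k₂} {k₃} k₁≤m k₂≤m k₃≤m = cong₂ _∧_ rows sums
    where
    rows : (rowWeak lexLt (map (comp₂ m) (k₁ ∷ k₂ ∷ k₃ ∷ [])) ∧ true) ∧ true ≡ rowWeak _<ᵇ_ (k₁ ∷ k₂ ∷ k₃ ∷ [])
    rows = trans (∧-identityʳ _) (trans (∧-identityʳ _) (rowWeak-comp₂ m (k₁ ∷ k₂ ∷ k₃ ∷ [])))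
    complement : T (k₁ + (k₂ + (k₃ + 0)) ≡ᵇ s) → T ((m ∸ k₁ + (m ∸ k₂ + (m ∸ k₃ + 0)) ≡ᵇ t) ∧ true)
    complement Σk≡s = from T-∧ (≡⇒≡ᵇ _ _ (complement-sum k₁≤m k₂≤m k₃≤m s+t≡3m (≡ᵇ⇒≡ _ _ Σk≡s)) , tt)
    sums : (k₁ + (k₂ + (k₃ + 0)) ≡ᵇ s) ∧ ((m ∸ k₁ + (m ∸ k₂ + (m ∸ k₃ + 0)) ≡ᵇ t) ∧ true) ≡ (k₁ + k₂ + k₃ ≡ᵇ s)
    sums = trans (∧-absorbed complement) (cong (_≡ᵇ s) (reassoc k₁ k₂ k₃))
      where
      reassoc : ∀ a b c → a + (b + (c + 0)) ≡ a + b + c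
      reassoc = solve-∀

-- Middle m s v k: (k, v, s − k − v) is a weakly increasing triple with largest part at most m.
Middle : ℕ → ℕ → ℕ → ℕ → Set
Middle m s v k = k ≤ v × k + v + v ≤ s × s ≤ k + v + m

middle? : ℕ → ℕ → ℕ → ℕ → Bool
middle? m s v k = (k ≤ᵇ v) ∧ (k + v + v ≤ᵇ s) ∧ (s ≤ᵇ k + v + m)

T-middle? : ∀ m s v k → T (middle? m s v k) ⇔ Middle m s v k
T-middle? m s v k = mk⇔
  (λ h → let (k≤v , h′) = to T-∧ h ; (lower , upper) = to T-∧ h′ in
         to T-≤ᵇ k≤v , to T-≤ᵇ lower , to T-≤ᵇ upper)
  (λ (k≤v , lower , upper) → from T-∧ (from T-≤ᵇ k≤v , from T-∧ (from T-≤ᵇ lower , from T-≤ᵇ upper)))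

∑-largestPart : ∀ m s k v → ∑[ k₃ < suc m ] indicator (triple? s k v k₃) ≡ indicator (middle? m s v k)
∑-largestPart m s k v with T? (middle? m s v k)
... | no ¬middle = trans (∑-zero (suc m) λ k₃ k₃≤m → indicator-false λ h →
                          ¬middle (from (T-middle? m s v k) (middle-of-triple (to (T-triple? s k v k₃) h) (s≤s⁻¹ k₃≤m))))
                         (sym (indicator-false ¬middle))
  where
  middle-of-triple : ∀ {k₃} → (k ≤ v × v ≤ k₃ × k + v + k₃ ≡ s) → k₃ ≤ m → Middle m s v k
  middle-of-triple (k≤v , v≤k₃ , Σ≡s) k₃≤m =
    k≤v , subst (k + v + v ≤_) Σ≡s (+-monoʳ-≤ (k + v) v≤k₃) , subst (_≤ k + v + m) Σ≡s (+-monoʳ-≤ (k + v) k₃≤m)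
... | yes middle = trans (∑-single (suc m) k₃ (s≤s k₃≤m) others)
                         (trans (indicator-true (from (T-triple? s k v k₃) (k≤v , v≤k₃ , Σ≡s)))
                                (sym (indicator-true middle)))
  where
  k≤v = proj₁ (to (T-middle? m s v k) middle)
  lower = proj₁ (proj₂ (to (T-middle? m s v k) middle))
  upper = proj₂ (proj₂ (to (T-middle? m s v k) middle))
  k₃ = s ∸ (k + v)
  Σ≡s : k + v + k₃ ≡ s
  Σ≡s = m+[n∸m]≡n (≤-trans (m≤m+n (k + v) v) lower)
  v≤k₃ : v ≤ k₃
  v≤k₃ = subst (_≤ k₃) (m+n∸m≡n (k + v) v) (∸-monoˡ-≤ (k + v) lower)
  k₃≤m : k₃ ≤ m
  k₃≤m = subst (k₃ ≤_) (m+n∸m≡n (k + v) m) (∸-monoˡ-≤ (k + v) upper)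
  others : ∀ k₃′ → k₃′ < suc m → k₃′ ≢ k₃ → indicator (triple? s k v k₃′) ≡ 0
  others k₃′ _ k₃′≢k₃ = indicator-false λ h →
    k₃′≢k₃ (trans (sym (m+n∸m≡n (k + v) k₃′)) (cong (_∸ (k + v)) (proj₂ (proj₂ (to (T-triple? s k v k₃′) h)))))

middleCount : ℕ → ℕ → ℕ → ℕ
middleCount m s v = ∑[ k < suc m ] indicator (middle? m s v k)

triples-byMiddle : ∀ m s → triples m s ≡ ∑[ v < suc m ] middleCount m s v
triples-byMiddle m s =
  trans (∑-comm (suc m) (suc m) (λ k v → ∑[ k₃ < suc m ] indicator (triple? s k v k₃)))
        (∑-cong (suc m) λ v _ → ∑-cong (suc m) λ k _ → ∑-largestPart m s k v)

middleCount-reflect-low : ∀ i d → let b = i + d in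
  middleCount (suc (b + b)) (3 + (b + b + b)) (suc i) ≡ middleCount (suc (b + b)) (2 + (b + b + b)) (suc (d + b))
middleCount-reflect-low i d =
  ∑-interval-shift _ d i _ _ (λ k → ⇔-trans (T-middle? _ _ _ k) (left k)) (λ k → ⇔-trans (T-middle? _ _ _ k) (right k))
                   (s≤s (s≤s (≤-trans (m≤m+n i d) (m≤m+n (i + d) (i + d)))))
  where
  left : ∀ k → Middle (suc ((i + d) + (i + d))) (3 + ((i + d) + (i + d) + (i + d))) (suc i) k ⇔ (suc d ≤ k × k ≤ suc i)
  left k = mk⇔
    (λ (k≤v , _ , upper) → +-cancelˡ-≤ (2 + (i + i + i + d + d)) (suc d) k (begin
        2 + (i + i + i + d + d) + suc d              ≡⟨ solve (i ∷ d ∷ []) ⟩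
        3 + ((i + d) + (i + d) + (i + d))            ≤⟨ upper ⟩
        k + suc i + suc ((i + d) + (i + d))          ≡⟨ solve (i ∷ d ∷ k ∷ []) ⟩
        2 + (i + i + i + d + d) + k                  ∎) , k≤v)
    (λ (d<k , k≤v) → k≤v , (begin
        k + suc i + suc i                            ≤⟨ +-monoˡ-≤ (suc i) (+-monoˡ-≤ (suc i) k≤v) ⟩
        suc i + suc i + suc i                        ≤⟨ m≤m+n _ (d + d + d) ⟩
        suc i + suc i + suc i + (d + d + d)          ≡⟨ solve (i ∷ d ∷ []) ⟩
        3 + ((i + d) + (i + d) + (i + d))            ∎) , (begin
        3 + ((i + d) + (i + d) + (i + d))            ≡⟨ solve (i ∷ d ∷ []) ⟩
        2 + (i + i + i + d + d) + suc d              ≤⟨ +-monoʳ-≤ (2 + (i + i + i + d + d)) d<k ⟩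
        2 + (i + i + i + d + d) + k                  ≡⟨ solve (i ∷ d ∷ k ∷ []) ⟩
        k + suc i + suc ((i + d) + (i + d))          ∎))
    where open ≤-Reasoning
  right : ∀ k → Middle (suc ((i + d) + (i + d))) (2 + ((i + d) + (i + d) + (i + d))) (suc (d + (i + d))) k ⇔ k + d ≤ i
  right k = mk⇔
    (λ (_ , lower , _) → +-cancelˡ-≤ (2 + (i + i + d + d + d)) (k + d) i (begin
        2 + (i + i + d + d + d) + (k + d)               ≡⟨ solve (i ∷ d ∷ k ∷ []) ⟩
        k + suc (d + (i + d)) + suc (d + (i + d))       ≤⟨ lower ⟩
        2 + ((i + d) + (i + d) + (i + d))               ≡⟨ solve (i ∷ d ∷ []) ⟩
        2 + (i + i + d + d + d) + i                     ∎))
    (λ k+d≤i → (begin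
        k                                               ≤⟨ m≤m+n k d ⟩
        k + d                                           ≤⟨ k+d≤i ⟩
        i                                               ≤⟨ m≤n+m i (d + d + 1) ⟩
        d + d + 1 + i                                   ≡⟨ solve (i ∷ d ∷ []) ⟩
        suc (d + (i + d))                               ∎) , (begin
        k + suc (d + (i + d)) + suc (d + (i + d))       ≡⟨ solve (i ∷ d ∷ k ∷ []) ⟩
        2 + (i + i + d + d + d) + (k + d)               ≤⟨ +-monoʳ-≤ (2 + (i + i + d + d + d)) k+d≤i ⟩
        2 + (i + i + d + d + d) + i                     ≡⟨ solve (i ∷ d ∷ []) ⟩
        2 + ((i + d) + (i + d) + (i + d))               ∎) , (begin
        2 + ((i + d) + (i + d) + (i + d))               ≤⟨ m≤m+n _ (k + d) ⟩
        2 + ((i + d) + (i + d) + (i + d)) + (k + d)     ≡⟨ solve (i ∷ d ∷ k ∷ []) ⟩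
        k + suc (d + (i + d)) + suc ((i + d) + (i + d)) ∎))
    where open ≤-Reasoning

middleCount-reflect-high : ∀ d e → let b = suc (d + e) in
  middleCount (suc (b + b)) (3 + (b + b + b)) (suc (suc (b + d))) ≡ middleCount (suc (b + b)) (2 + (b + b + b)) (suc e)
middleCount-reflect-high d e =
  sym (∑-interval-shift _ d e _ _ (λ k → ⇔-trans (T-middle? _ _ _ k) (right k)) (λ k → ⇔-trans (T-middle? _ _ _ k) (left k))
                        (s≤s (s≤s (≤-trans (m≤n+m e d) (≤-trans (n≤1+n (d + e)) (m≤m+n (suc (d + e)) (suc (d + e))))))))
  where
  left : ∀ k → Middle (suc (suc (d + e) + suc (d + e))) (3 + (suc (d + e) + suc (d + e) + suc (d + e)))
                      (suc (suc (suc (d + e) + d))) k ⇔ k + d ≤ e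
  left k = mk⇔
    (λ (_ , lower , _) → +-cancelˡ-≤ (6 + (d + d + d + e + e)) (k + d) e (begin
        6 + (d + d + d + e + e) + (k + d)                           ≡⟨ solve (d ∷ e ∷ k ∷ []) ⟩
        k + suc (suc (suc (d + e) + d)) + suc (suc (suc (d + e) + d)) ≤⟨ lower ⟩
        3 + (suc (d + e) + suc (d + e) + suc (d + e))               ≡⟨ solve (d ∷ e ∷ []) ⟩
        6 + (d + d + d + e + e) + e                                 ∎))
    (λ k+d≤e → (begin
        k                                                           ≤⟨ m≤m+n k d ⟩
        k + d                                                       ≤⟨ k+d≤e ⟩
        e                                                           ≤⟨ m≤n+m e (d + d + 3) ⟩
        d + d + 3 + e                                               ≡⟨ solve (d ∷ e ∷ []) ⟩
        suc (suc (suc (d + e) + d))                                 ∎) , (begin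
        k + suc (suc (suc (d + e) + d)) + suc (suc (suc (d + e) + d)) ≡⟨ solve (d ∷ e ∷ k ∷ []) ⟩
        6 + (d + d + d + e + e) + (k + d)                           ≤⟨ +-monoʳ-≤ (6 + (d + d + d + e + e)) k+d≤e ⟩
        6 + (d + d + d + e + e) + e                                 ≡⟨ solve (d ∷ e ∷ []) ⟩
        3 + (suc (d + e) + suc (d + e) + suc (d + e))               ∎) , (begin
        3 + (suc (d + e) + suc (d + e) + suc (d + e))               ≤⟨ m≤m+n _ (k + d) ⟩
        3 + (suc (d + e) + suc (d + e) + suc (d + e)) + (k + d)     ≡⟨ solve (d ∷ e ∷ k ∷ []) ⟩
        k + suc (suc (suc (d + e) + d)) + suc (suc (d + e) + suc (d + e)) ∎))
    where open ≤-Reasoning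
  right : ∀ k → Middle (suc (suc (d + e) + suc (d + e))) (2 + (suc (d + e) + suc (d + e) + suc (d + e))) (suc e) k
                ⇔ (suc d ≤ k × k ≤ suc e)
  right k = mk⇔
    (λ (k≤v , _ , upper) → +-cancelˡ-≤ (4 + (d + d + e + e + e)) (suc d) k (begin
        4 + (d + d + e + e + e) + suc d                             ≡⟨ solve (d ∷ e ∷ []) ⟩
        2 + (suc (d + e) + suc (d + e) + suc (d + e))               ≤⟨ upper ⟩
        k + suc e + suc (suc (d + e) + suc (d + e))                 ≡⟨ solve (d ∷ e ∷ k ∷ []) ⟩
        4 + (d + d + e + e + e) + k                                 ∎) , k≤v)
    (λ (d<k , k≤v) → k≤v , (begin
        k + suc e + suc e                                           ≤⟨ +-monoˡ-≤ (suc e) (+-monoˡ-≤ (suc e) k≤v) ⟩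
        suc e + suc e + suc e                                       ≤⟨ m≤m+n _ (d + d + d + 2) ⟩
        suc e + suc e + suc e + (d + d + d + 2)                     ≡⟨ solve (d ∷ e ∷ []) ⟩
        2 + (suc (d + e) + suc (d + e) + suc (d + e))               ∎) , (begin
        2 + (suc (d + e) + suc (d + e) + suc (d + e))               ≡⟨ solve (d ∷ e ∷ []) ⟩
        4 + (d + d + e + e + e) + suc d                             ≤⟨ +-monoʳ-≤ (4 + (d + d + e + e + e)) d<k ⟩
        4 + (d + d + e + e + e) + k                                 ≡⟨ solve (d ∷ e ∷ k ∷ []) ⟩
        k + suc e + suc (suc (d + e) + suc (d + e))                 ∎))
    where open ≤-Reasoning

middleCount-reflect : ∀ b i → i ≤ b + b →
  middleCount (suc (b + b)) (3 + (b + b + b)) (suc i) ≡ middleCount (suc (b + b)) (2 + (b + b + b)) (suc (b + b ∸ i))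
middleCount-reflect b i i≤2b with i ≤? b
... | yes i≤b with d , refl ← m≤n⇒∃[o]m+o≡n i≤b =
  trans (middleCount-reflect-low i d)
        (cong (λ v → middleCount (suc ((i + d) + (i + d))) (2 + ((i + d) + (i + d) + (i + d))) (suc v)) (sym reflected))
  where
  reflected : (i + d) + (i + d) ∸ i ≡ d + (i + d)
  reflected = trans (cong (_∸ i) (+-assoc i d (i + d))) (m+n∸m≡n i (d + (i + d)))
... | no i≰b with d , refl ← m≤n⇒∃[o]m+o≡n (≰⇒> i≰b)
             with e , refl ← m≤n⇒∃[o]m+o≡n (+-cancelˡ-≤ b (suc d) b (subst (_≤ b + b) (sym (+-suc b d)) i≤2b)) =
  trans (middleCount-reflect-high d e)
        (cong (λ v → middleCount (suc (b + b)) (2 + (b + b + b)) (suc v)) (sym reflected))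
  where
  split : suc (d + e) + suc (d + e) ≡ suc (suc (d + e) + d) + e
  split = solve (d ∷ e ∷ [])
  reflected : suc (d + e) + suc (d + e) ∸ suc (suc (d + e) + d) ≡ e
  reflected = trans (cong (_∸ suc (suc (d + e) + d)) split) (m+n∸m≡n (suc (suc (d + e) + d)) e)

middleCount-empty : ∀ m s → m < s → middleCount m s 0 ≡ 0
middleCount-empty m s m<s = ∑-zero (suc m) λ k _ → indicator-false (no-triple k ∘ to (T-middle? m s 0 k))
  where
  no-triple : ∀ k → ¬ Middle m s 0 k
  no-triple .0 (z≤n , _ , s≤m) = <⇒≱ m<s s≤m

triples-flat : ∀ b → triples (suc (b + b)) (2 + (b + b + b)) ≡ triples (suc (b + b)) (3 + (b + b + b))
triples-flat b = begin
  triples m s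
    ≡⟨ triples-byMiddle m s ⟩
  middleCount m s 0 + ∑[ i < m ] middleCount m s (suc i)
    ≡⟨ cong₂ _+_ (middleCount-empty m s m<s) (∑-reverse m (λ i → middleCount m s (suc i))) ⟩
  0 + ∑[ i < m ] middleCount m s (suc (b + b ∸ i))
    ≡⟨ cong₂ _+_ (sym (middleCount-empty m s′ (≤-trans m<s (n≤1+n s))))
                 (sym (∑-cong m λ i i<m → middleCount-reflect b i (s≤s⁻¹ i<m))) ⟩
  middleCount m s′ 0 + ∑[ i < m ] middleCount m s′ (suc i)
    ≡⟨ sym (triples-byMiddle m s′) ⟩
  triples m s′
    ∎
  where
  open ≡-Reasoning
  m = suc (b + b)
  s = 2 + (b + b + b)
  s′ = 3 + (b + b + b)
  m<s : m < s
  m<s = s≤s (s≤s (m≤m+n (b + b) b))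

pleth-twoRow : ∀ ν n A B →
  pleth ν n (A ∷ suc B ∷ []) ≡ ℤ.+ monCoeff ν n (A ∷ suc B ∷ []) ℤ.- ℤ.+ monCoeff ν n (suc A ∷ B ∷ [])
pleth-twoRow ν n A B = begin
  (ℤ.+ 1 ℤ.* ℤ.+ c (A + 0 ∷ suc B + 1 ∸ 1 ∷ [])) ℤ.+ ((ℤ.- (ℤ.+ 1) ℤ.* ℤ.+ c (A + 1 ∷ B + 0 ∷ [])) ℤ.+ ℤ.+ 0)
    ≡⟨ cong₂ (λ α β → (ℤ.+ 1 ℤ.* ℤ.+ c α) ℤ.+ ((ℤ.- (ℤ.+ 1) ℤ.* ℤ.+ c β) ℤ.+ ℤ.+ 0))
             (cong₂ (λ a b → a ∷ b ∷ []) (+-identityʳ A) (m+n∸n≡m (suc B) 1))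
             (cong₂ (λ a b → a ∷ b ∷ []) (+-comm A 1) (+-identityʳ B)) ⟩
  (ℤ.+ 1 ℤ.* ℤ.+ c (A ∷ suc B ∷ [])) ℤ.+ ((ℤ.- (ℤ.+ 1) ℤ.* ℤ.+ c (suc A ∷ B ∷ [])) ℤ.+ ℤ.+ 0)
    ≡⟨ cong₂ ℤ._+_ (ℤₚ.*-identityˡ (ℤ.+ c (A ∷ suc B ∷ [])))
                   (trans (ℤₚ.+-identityʳ _) (ℤₚ.-1*i≡-i (ℤ.+ c (suc A ∷ B ∷ [])))) ⟩
  ℤ.+ c (A ∷ suc B ∷ []) ℤ.- ℤ.+ c (suc A ∷ B ∷ [])
    ∎
  where
  open ≡-Reasoning
  c = monCoeff ν n

pleth-3-vanishes : ∀ b → pleth (3 ∷ []) (suc (b + b)) (2 + (b + b + b) ∷ suc (b + b + b) ∷ []) ≡ ℤ.+ 0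
pleth-3-vanishes b = begin
  pleth (3 ∷ []) m (2 + (b + b + b) ∷ suc (b + b + b) ∷ [])
    ≡⟨ pleth-twoRow (3 ∷ []) m (2 + (b + b + b)) (b + b + b) ⟩
  ℤ.+ monCoeff (3 ∷ []) m (2 + (b + b + b) ∷ suc (b + b + b) ∷ []) ℤ.- ℤ.+ monCoeff (3 ∷ []) m (3 + (b + b + b) ∷ b + b + b ∷ [])
    ≡⟨ cong₂ (λ x y → ℤ.+ x ℤ.- ℤ.+ y) (monCoeff-3≡triples m _ _ sum₁) (monCoeff-3≡triples m _ _ sum₂) ⟩
  ℤ.+ triples m (2 + (b + b + b)) ℤ.- ℤ.+ triples m (3 + (b + b + b))
    ≡⟨ cong (λ x → x ℤ.- ℤ.+ triples m (3 + (b + b + b))) (cong ℤ.+_ (triples-flat b)) ⟩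
  ℤ.+ triples m (3 + (b + b + b)) ℤ.- ℤ.+ triples m (3 + (b + b + b))
    ≡⟨ ℤₚ.+-inverseʳ (ℤ.+ triples m (3 + (b + b + b))) ⟩
  ℤ.+ 0
    ∎
  where
  open ≡-Reasoning
  m = suc (b + b)
  sum₁ : 2 + (b + b + b) + suc (b + b + b) ≡ suc (b + b) + suc (b + b) + suc (b + b)
  sum₁ = solve (b ∷ [])
  sum₂ : 3 + (b + b + b) + (b + b + b) ≡ suc (b + b) + suc (b + b) + suc (b + b)
  sum₂ = solve (b ∷ [])

-- Semistandard tableaux of content (n, n, n) with at most two rows

row : ℕ → ℕ → ℕ → List ℕ
row a x y = replicate a 1 ++ replicate x 2 ++ replicate y 3

entry? : ℕ → Bool
entry? e = (1 ≤ᵇ e) ∧ (e ≤ᵇ 3)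

weaklyIncreasing⇒row : ∀ r → rowWeak _<ᵇ_ r ≡ true → all entry? r ≡ true → ∃[ a ] ∃[ x ] ∃[ y ] r ≡ row a x y
weaklyIncreasing⇒row [] _ _ = 0 , 0 , 0 , refl
weaklyIncreasing⇒row (e ∷ r) inc entries
  with weaklyIncreasing⇒row r (tail-increasing r inc) (∧-conicalʳ (entry? e) _ entries)
  where
  tail-increasing : ∀ r → rowWeak _<ᵇ_ (e ∷ r) ≡ true → rowWeak _<ᵇ_ r ≡ true
  tail-increasing [] _ = refl
  tail-increasing (_ ∷ _) inc = ∧-conicalʳ _ _ inc
weaklyIncreasing⇒row (1 ∷ _) _ _ | a , x , y , refl = suc a , x , y , refl
weaklyIncreasing⇒row (2 ∷ _) _ _ | zero , x , y , refl = 0 , suc x , y , refl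
weaklyIncreasing⇒row (3 ∷ _) _ _ | zero , zero , y , refl = 0 , 0 , suc y , refl
weaklyIncreasing⇒row (2 ∷ _) () _ | suc a , x , y , refl
weaklyIncreasing⇒row (3 ∷ _) () _ | suc a , x , y , refl
weaklyIncreasing⇒row (3 ∷ _) () _ | zero , suc x , y , refl
weaklyIncreasing⇒row (0 ∷ _) _ () | _
weaklyIncreasing⇒row (suc (suc (suc (suc _))) ∷ _) _ () | _

row-weaklyIncreasing : ∀ a x y → rowWeak _<ᵇ_ (row a x y) ≡ true
row-weaklyIncreasing (suc (suc a)) x y = row-weaklyIncreasing (suc a) x y
row-weaklyIncreasing 1 (suc x) y = row-weaklyIncreasing 0 (suc x) y
row-weaklyIncreasing 1 zero (suc y) = row-weaklyIncreasing 0 0 (suc y)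
row-weaklyIncreasing 1 zero zero = refl
row-weaklyIncreasing zero (suc (suc x)) y = row-weaklyIncreasing 0 (suc x) y
row-weaklyIncreasing zero 1 (suc y) = row-weaklyIncreasing 0 0 (suc y)
row-weaklyIncreasing zero 1 zero = refl
row-weaklyIncreasing zero zero (suc (suc y)) = row-weaklyIncreasing 0 0 (suc y)
row-weaklyIncreasing zero zero 1 = refl
row-weaklyIncreasing zero zero zero = refl

row-entries : ∀ a x y → all entry? (row a x y) ≡ true
row-entries (suc a) x y = row-entries a x y
row-entries zero (suc x) y = row-entries 0 x y
row-entries zero zero (suc y) = row-entries 0 0 y
row-entries zero zero zero = refl

length-row : ∀ a x y → length (row a x y) ≡ a + x + y
length-row (suc a) x y = cong suc (length-row a x y)
length-row zero (suc x) y = cong suc (length-row 0 x y)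
length-row zero zero (suc y) = cong suc (length-row 0 0 y)
length-row zero zero zero = refl

countIn-row₁ : ∀ a x y → countIn 1 (row a x y) ≡ a
countIn-row₁ (suc a) x y = cong suc (countIn-row₁ a x y)
countIn-row₁ zero (suc x) y = countIn-row₁ 0 x y
countIn-row₁ zero zero (suc y) = countIn-row₁ 0 0 y
countIn-row₁ zero zero zero = refl

countIn-row₂ : ∀ a x y → countIn 2 (row a x y) ≡ x
countIn-row₂ (suc a) x y = countIn-row₂ a x y
countIn-row₂ zero (suc x) y = cong suc (countIn-row₂ 0 x y)
countIn-row₂ zero zero (suc y) = countIn-row₂ 0 0 y
countIn-row₂ zero zero zero = refl

countIn-row₃ : ∀ a x y → countIn 3 (row a x y) ≡ y
countIn-row₃ (suc a) x y = countIn-row₃ a x y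
countIn-row₃ zero (suc x) y = countIn-row₃ 0 x y
countIn-row₃ zero zero (suc y) = cong suc (countIn-row₃ 0 0 y)
countIn-row₃ zero zero zero = refl

-- Strict columns: the 2s of the second row sit under 1s, its 3s under 1s or 2s.
colStrict-row⇒ : ∀ a x y a′ b c → colStrict _<ᵇ_ (row a x y) (row a′ b c) ≡ true → a′ ≡ 0 × b + c ≤ a + x
colStrict-row⇒ (suc a) x y zero (suc b) c h = let (a′≡0 , bc≤ax) = colStrict-row⇒ a x y 0 b c h in a′≡0 , s≤s bc≤ax
colStrict-row⇒ (suc a) x y zero zero (suc c) h = let (a′≡0 , c≤ax) = colStrict-row⇒ a x y 0 0 c h in a′≡0 , s≤s c≤ax
colStrict-row⇒ zero (suc x) y zero zero (suc c) h = let (a′≡0 , c≤x) = colStrict-row⇒ 0 x y 0 0 c h in a′≡0 , s≤s c≤x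
colStrict-row⇒ a x y zero zero zero h = refl , z≤n
colStrict-row⇒ (suc a) x y (suc a′) b c ()
colStrict-row⇒ zero (suc x) y (suc a′) b c ()
colStrict-row⇒ zero zero (suc y) (suc a′) b c ()
colStrict-row⇒ zero zero zero (suc a′) b c ()
colStrict-row⇒ zero (suc x) y zero (suc b) c ()
colStrict-row⇒ zero zero (suc y) zero (suc b) c ()
colStrict-row⇒ zero zero zero zero (suc b) c ()
colStrict-row⇒ zero zero (suc y) zero zero (suc c) ()
colStrict-row⇒ zero zero zero zero zero (suc c) ()

⇒colStrict-row : ∀ a x y b c → b ≤ a → b + c ≤ a + x → colStrict _<ᵇ_ (row a x y) (row 0 b c) ≡ true
⇒colStrict-row (suc a) x y (suc b) c (s≤s b≤a) (s≤s bc≤ax) = ⇒colStrict-row a x y b c b≤a bc≤ax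
⇒colStrict-row (suc a) x y zero (suc c) _ (s≤s c≤ax) = ⇒colStrict-row a x y 0 c z≤n c≤ax
⇒colStrict-row zero (suc x) y zero (suc c) _ (s≤s c≤x) = ⇒colStrict-row 0 x y 0 c z≤n c≤x
⇒colStrict-row a x y zero zero _ _ with row a x y
... | [] = refl
... | _ ∷ _ = refl

insertRow-row : ∀ a x y → insertRow 3 (insertRow 2 (insertRow 1 (row a x y))) ≡ row (suc a) (suc x) (suc y)
insertRow-row a x y = trans (cong (insertRow 3 ∘ insertRow 2) (insert₁ a x y))
                            (trans (cong (insertRow 3) (insert₂ (suc a) x y)) (insert₃ (suc a) (suc x) y))
  where
  insert₁ : ∀ a x y → insertRow 1 (row a x y) ≡ row (suc a) x y
  insert₁ (suc a) x y = refl
  insert₁ zero (suc x) y = refl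
  insert₁ zero zero (suc y) = refl
  insert₁ zero zero zero = refl
  insert₂ : ∀ a x y → insertRow 2 (row a x y) ≡ row a (suc x) y
  insert₂ (suc a) x y = cong (1 ∷_) (insert₂ a x y)
  insert₂ zero (suc x) y = refl
  insert₂ zero zero (suc y) = refl
  insert₂ zero zero zero = refl
  insert₃ : ∀ a x y → insertRow 3 (row a x y) ≡ row a x (suc y)
  insert₃ (suc a) x y = cong (1 ∷_) (insert₃ a x y)
  insert₃ zero (suc x) y = cong (2 ∷_) (insert₃ 0 x y)
  insert₃ zero zero (suc y) = refl
  insert₃ zero zero zero = refl

record Semistandard₃ (μ : List ℕ) (n : ℕ) (T : List (List ℕ)) : Set where
  field
    shape : shapeOf T ≡ μ
    entries : all (all entry?) T ≡ true
    rows : all (rowWeak _<ᵇ_) T ≡ true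
    columns : colsStrict _<ᵇ_ T ≡ true
    ones : countIn 1 (concat T) ≡ n
    twos : countIn 2 (concat T) ≡ n
    threes : countIn 3 (concat T) ≡ n

isSSYT3⇔ : ∀ μ n T → isSSYT3 μ n T ≡ true ⇔ Semistandard₃ μ n T
isSSYT3⇔ μ n T = mk⇔
  (λ h → let (shape , h₁) = to ∧-true⇔ h ; (entries , h₂) = to ∧-true⇔ h₁ ; (semi , h₃) = to ∧-true⇔ h₂
             (rows , columns) = to ∧-true⇔ semi ; (ones , h₄) = to ∧-true⇔ h₃ ; (twos , threes) = to ∧-true⇔ h₄ in
         record { shape = to eqList-true⇔ shape ; entries = entries ; rows = rows ; columns = columns
                ; ones = to ≡ᵇ-true⇔ ones ; twos = to ≡ᵇ-true⇔ twos ; threes = to ≡ᵇ-true⇔ threes })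
  (λ S → let open Semistandard₃ S in
         cong₂ _∧_ (from eqList-true⇔ shape) (cong₂ _∧_ entries (cong₂ _∧_ (cong₂ _∧_ rows columns)
           (cong₂ _∧_ (from ≡ᵇ-true⇔ ones) (cong₂ _∧_ (from ≡ᵇ-true⇔ twos) (from ≡ᵇ-true⇔ threes))))))

tableau₂ : ℕ → ℕ → ℕ → ℕ → ℕ → List (List ℕ)
tableau₂ n x y b c = row n x y ∷ row 0 b c ∷ []

countIn-concat₂ : ∀ i r₁ r₂ → countIn i (concat (r₁ ∷ r₂ ∷ [])) ≡ countIn i r₁ + countIn i r₂
countIn-concat₂ i r₁ r₂ = begin
  countIn i (r₁ ++ r₂ ++ [])
    ≡⟨ cong length (filter-++ (T? ∘ (i ≡ᵇ_)) r₁ (r₂ ++ [])) ⟩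
  length (filterᵇ (i ≡ᵇ_) r₁ ++ filterᵇ (i ≡ᵇ_) (r₂ ++ []))
    ≡⟨ length-++ (filterᵇ (i ≡ᵇ_) r₁) ⟩
  countIn i r₁ + countIn i (r₂ ++ [])
    ≡⟨ cong (λ r → countIn i r₁ + countIn i r) (++-identityʳ r₂) ⟩
  countIn i r₁ + countIn i r₂
    ∎
  where open ≡-Reasoning

tableau₂-counts : ∀ n x y b c → let T = concat (tableau₂ n x y b c) in
                  countIn 1 T ≡ n × countIn 2 T ≡ x + b × countIn 3 T ≡ y + c
tableau₂-counts n x y b c =
  trans (countIn-concat₂ 1 (row n x y) (row 0 b c)) (trans (cong₂ _+_ (countIn-row₁ n x y) (countIn-row₁ 0 b c)) (+-identityʳ n)) ,
  trans (countIn-concat₂ 2 (row n x y) (row 0 b c)) (cong₂ _+_ (countIn-row₂ n x y) (countIn-row₂ 0 b c)) ,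
  trans (countIn-concat₂ 3 (row n x y) (row 0 b c)) (cong₂ _+_ (countIn-row₃ n x y) (countIn-row₃ 0 b c))

record TwoRowView (n j : ℕ) (T : List (List ℕ)) : Set where
  constructor twoRowView
  field
    x y b c : ℕ
    T≡ : T ≡ tableau₂ n x y b c
    x+b≡n : x + b ≡ n
    y+c≡n : y + c ≡ n
    b+c≡j : b + c ≡ j
    columns : b + c ≤ n + x

twoRowView-of : ∀ {A j n T} → Semistandard₃ (A ∷ j ∷ []) n T → TwoRowView n j T
twoRowView-of {T = r₁ ∷ r₂ ∷ []} S
  with weaklyIncreasing⇒row r₁ (∧-conicalˡ _ _ rows) (∧-conicalˡ _ _ entries)
     | weaklyIncreasing⇒row r₂ (∧-conicalˡ _ _ (∧-conicalʳ (rowWeak _<ᵇ_ r₁) _ rows))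
                              (∧-conicalˡ _ _ (∧-conicalʳ (all entry? r₁) _ entries))
  where open Semistandard₃ S
... | a , x , y , refl | a′ , b , c , refl
  with colStrict-row⇒ a x y a′ b c (∧-conicalˡ _ _ (Semistandard₃.columns S))
... | refl , columns with refl ← trans (sym (proj₁ (tableau₂-counts a x y b c))) (Semistandard₃.ones S) =
  twoRowView x y b c refl (trans (sym twos′) twos) (trans (sym threes′) threes)
             (trans (sym (length-row 0 b c)) (∷-injectiveˡ (∷-injectiveʳ shape))) columns
  where
  open Semistandard₃ S hiding (columns)
  twos′ = proj₁ (proj₂ (tableau₂-counts a x y b c))
  threes′ = proj₂ (proj₂ (tableau₂-counts a x y b c))
twoRowView-of {T = []} S with () ← Semistandard₃.shape S
twoRowView-of {T = _ ∷ []} S with () ← Semistandard₃.shape S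
twoRowView-of {T = _ ∷ _ ∷ _ ∷ _} S with () ← Semistandard₃.shape S

oneRow-of : ∀ {A n T} → Semistandard₃ (A ∷ []) n T → T ≡ row n n n ∷ []
oneRow-of {T = r ∷ []} S
  with a , x , y , refl ← weaklyIncreasing⇒row r (∧-conicalˡ (rowWeak _<ᵇ_ r) _ (Semistandard₃.rows S))
                                                (∧-conicalˡ (all entry? r) _ (Semistandard₃.entries S)) =
  cong (_∷ []) (row-cong (counted 1 (countIn-row₁ a x y) ones) (counted 2 (countIn-row₂ a x y) twos)
                         (counted 3 (countIn-row₃ a x y) threes))
  where
  open Semistandard₃ S
  counted : ∀ i {k n} → countIn i (row a x y) ≡ k → countIn i (row a x y ++ []) ≡ n → k ≡ n
  counted i count count′ = trans (sym count) (trans (cong (countIn i) (sym (++-identityʳ (row a x y)))) count′)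
  row-cong : ∀ {a x y a′ x′ y′} → a ≡ a′ → x ≡ x′ → y ≡ y′ → row a x y ≡ row a′ x′ y′
  row-cong refl refl refl = refl
oneRow-of {T = []} S with () ← Semistandard₃.shape S
oneRow-of {T = _ ∷ _ ∷ _} S with () ← Semistandard₃.shape S

tableau₂-semistandard : ∀ {N X Y b c} → X + b ≡ N → Y + c ≡ N → b + c ≤ N + X →
                        Semistandard₃ (N + X + Y ∷ b + c ∷ []) N (tableau₂ N X Y b c)
tableau₂-semistandard {N} {X} {Y} {b} {c} X+b≡N Y+c≡N columns = record
  { shape = cong₂ (λ l₁ l₂ → l₁ ∷ l₂ ∷ []) (length-row N X Y) (length-row 0 b c)
  ; entries = cong₂ _∧_ (row-entries N X Y) (cong₂ _∧_ (row-entries 0 b c) refl)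
  ; rows = cong₂ _∧_ (row-weaklyIncreasing N X Y) (cong₂ _∧_ (row-weaklyIncreasing 0 b c) refl)
  ; columns = cong₂ _∧_ (⇒colStrict-row N X Y b c (subst (b ≤_) X+b≡N (m≤n+m b X)) columns) refl
  ; ones = ones
  ; twos = trans twos X+b≡N
  ; threes = trans threes Y+c≡N
  }
  where
  counts = tableau₂-counts N X Y b c
  ones = proj₁ counts
  twos = proj₁ (proj₂ counts)
  threes = proj₂ (proj₂ counts)

tableau₂-IsSSYT : ∀ N X Y b c → X + b ≡ N → Y + c ≡ N → b + c ≤ N + X → 1 ≤ b + c →
                  IsSSYT (N + X + Y ∷ b + c ∷ []) N (tableau₂ N X Y b c)
tableau₂-IsSSYT N X Y b c X+b≡N Y+c≡N columns 1≤b+c =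
  1≤N+N⇒1≤N (≤-trans 1≤b+c (≤-trans columns (+-monoʳ-≤ N (subst (X ≤_) X+b≡N (m≤m+n X b))))) ,
  cong₂ _∧_ (cong₂ _∧_ (≤⇒≤ᵇ-true (≤-trans 1≤b+c second≤first)) (cong₂ _∧_ (≤⇒≤ᵇ-true 1≤b+c) refl))
            (cong₂ _∧_ (≤⇒≤ᵇ-true second≤first) refl) ,
  size ,
  from (isSSYT3⇔ _ _ _) (tableau₂-semistandard X+b≡N Y+c≡N columns)
  where
  1≤N+N⇒1≤N : ∀ {N} → 1 ≤ N + N → 1 ≤ N
  1≤N+N⇒1≤N {suc _} _ = s≤s z≤n
  second≤first : b + c ≤ N + X + Y
  second≤first = ≤-trans columns (m≤m+n (N + X) Y)
  size : N + X + Y + (b + c + 0) ≡ 3 * N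
  size = begin
    N + X + Y + (b + c + 0) ≡⟨ regroup N X Y b c ⟩
    N + (X + b) + (Y + c)   ≡⟨ cong₂ (λ p q → N + p + q) X+b≡N Y+c≡N ⟩
    N + N + N               ≡⟨ solve (N ∷ []) ⟩
    3 * N                   ∎
    where
    open ≡-Reasoning
    regroup : ∀ N X Y b c → N + X + Y + (b + c + 0) ≡ N + (X + b) + (Y + c)
    regroup = solve-∀

row-IsSSYT : ∀ {N} → 1 ≤ N → IsSSYT (N + N + N ∷ []) N (row N N N ∷ [])
row-IsSSYT {N} 1≤N =
  1≤N ,
  cong₂ _∧_ (cong₂ _∧_ (≤⇒≤ᵇ-true (≤-trans 1≤N (≤-trans (m≤m+n N N) (m≤m+n (N + N) N)))) refl) refl ,
  size ,
  from (isSSYT3⇔ (N + N + N ∷ []) N (row N N N ∷ [])) (record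
    { shape = cong (λ l → l ∷ []) (length-row N N N)
    ; entries = cong₂ _∧_ (row-entries N N N) refl
    ; rows = cong₂ _∧_ (row-weaklyIncreasing N N N) refl
    ; columns = refl
    ; ones = counted 1 (countIn-row₁ N N N)
    ; twos = counted 2 (countIn-row₂ N N N)
    ; threes = counted 3 (countIn-row₃ N N N)
    })
  where
  size : N + N + N + 0 ≡ 3 * N
  size = solve (N ∷ [])
  counted : ∀ i → countIn i (row N N N) ≡ N → countIn i (row N N N ++ []) ≡ N
  counted i = trans (cong (countIn i) (++-identityʳ (row N N N)))

views-agree : ∀ {n j T T′} (v : TwoRowView n j T) (w : TwoRowView n j T′) → TwoRowView.b v ≡ TwoRowView.b w → T ≡ T′
views-agree {n} (twoRowView x y b c refl x+b≡n y+c≡n b+c≡j _) (twoRowView x′ y′ .b c′ refl x′+b≡n y′+c′≡n b+c′≡j _) refl =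
  trans (cong₂ (λ x y → tableau₂ n x y b c) x≡x′ y≡y′) (cong (tableau₂ n x′ y′ b) c≡c′)
  where
  c≡c′ = +-cancelˡ-≡ b c c′ (trans b+c≡j (sym b+c′≡j))
  x≡x′ = +-cancelʳ-≡ b x x′ (trans x+b≡n (sym x′+b≡n))
  y≡y′ = +-cancelʳ-≡ c y y′ (trans y+c≡n (trans (sym y′+c′≡n) (cong (y′ +_) (sym c≡c′))))

view-bounds : ∀ {n j T} (v : TwoRowView n j T) → let b = TwoRowView.b v in j ≤ b + n × b + j ≤ n + n
view-bounds {n} {j} (twoRowView x y b c _ x+b≡n y+c≡n b+c≡j columns) =
  subst (_≤ b + n) b+c≡j (+-monoʳ-≤ b (subst (c ≤_) y+c≡n (m≤n+m c y))) ,
  (begin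
    b + j           ≡⟨ cong (b +_) (sym b+c≡j) ⟩
    b + (b + c)     ≤⟨ +-monoʳ-≤ b columns ⟩
    b + (n + x)     ≡⟨ solve (b ∷ n ∷ x ∷ []) ⟩
    n + (x + b)     ≡⟨ cong (n +_) x+b≡n ⟩
    n + n           ∎)
  where open ≤-Reasoning

multiplicity : ∀ {A : Set} → DecidableEquality A → A → List A → ℕ
multiplicity _≟_ a xs = length (filterᵇ (λ x → ⌊ x ≟ a ⌋) xs)

multiplicity-++ : ∀ {A : Set} (_≟_ : DecidableEquality A) a xs ys →
                  multiplicity _≟_ a (xs ++ ys) ≡ multiplicity _≟_ a xs + multiplicity _≟_ a ys
multiplicity-++ _≟_ a xs ys =
  trans (cong length (filter-++ (T? ∘ (λ x → ⌊ x ≟ a ⌋)) xs ys)) (length-++ (filterᵇ (λ x → ⌊ x ≟ a ⌋) xs))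

module _ {A : Set} (_≟_ : DecidableEquality A) where

  multiplicity-∷ : ∀ a x xs → multiplicity _≟_ a (x ∷ xs) ≡ indicator ⌊ x ≟ a ⌋ + multiplicity _≟_ a xs
  multiplicity-∷ a x xs with x ≟ a
  ... | yes _ = refl
  ... | no _ = refl

  multiplicity-map-∷ : ∀ x y ys F →
    multiplicity (≡-dec _≟_) (y ∷ ys) (map (x ∷_) F) ≡ indicator ⌊ x ≟ y ⌋ * multiplicity (≡-dec _≟_) ys F
  multiplicity-map-∷ x y ys [] = sym (*-zeroʳ (indicator ⌊ x ≟ y ⌋))
  multiplicity-map-∷ x y ys (f ∷ F) with x ≟ y | ≡-dec _≟_ f ys | multiplicity-map-∷ x y ys F
  ... | yes _ | yes _ | ih = cong suc ih
  ... | yes _ | no _ | ih = ih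
  ... | no _ | _ | ih = ih

  multiplicity-concatMap-∷ : ∀ y ys F xs →
    multiplicity (≡-dec _≟_) (y ∷ ys) (concatMap (λ x → map (x ∷_) F) xs)
    ≡ multiplicity _≟_ y xs * multiplicity (≡-dec _≟_) ys F
  multiplicity-concatMap-∷ y ys F [] = refl
  multiplicity-concatMap-∷ y ys F (x ∷ xs) = begin
    multiplicity _≟L_ (y ∷ ys) (map (x ∷_) F ++ concatMap (λ x → map (x ∷_) F) xs)
      ≡⟨ multiplicity-++ _≟L_ (y ∷ ys) (map (x ∷_) F) _ ⟩
    multiplicity _≟L_ (y ∷ ys) (map (x ∷_) F) + multiplicity _≟L_ (y ∷ ys) (concatMap (λ x → map (x ∷_) F) xs)
      ≡⟨ cong₂ _+_ (multiplicity-map-∷ x y ys F) (multiplicity-concatMap-∷ y ys F xs) ⟩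
    indicator ⌊ x ≟ y ⌋ * m + multiplicity _≟_ y xs * m
      ≡⟨ sym (*-distribʳ-+ m (indicator ⌊ x ≟ y ⌋) (multiplicity _≟_ y xs)) ⟩
    (indicator ⌊ x ≟ y ⌋ + multiplicity _≟_ y xs) * m
      ≡⟨ cong (_* m) (sym (multiplicity-∷ y x xs)) ⟩
    multiplicity _≟_ y (x ∷ xs) * m
      ∎
    where
    open ≡-Reasoning
    _≟L_ = ≡-dec _≟_
    m = multiplicity _≟L_ ys F

  length-filterᵇ-single : ∀ {p : A → Bool} {a} → (∀ x → p x ≡ true → x ≡ a) →
    ∀ xs → length (filterᵇ p xs) ≡ indicator (p a) * multiplicity _≟_ a xs
  length-filterᵇ-single {p} {a} only [] = sym (*-zeroʳ (indicator (p a)))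
  length-filterᵇ-single {p} {a} only (x ∷ xs) with x ≟ a
  ... | yes refl with p a | length-filterᵇ-single only xs
  ...   | true | ih = cong suc ih
  ...   | false | ih = ih
  length-filterᵇ-single {p} {a} only (x ∷ xs) | no x≢a with p x in px | length-filterᵇ-single only xs
  ...   | true | _ = ⊥-elim (x≢a (only x px))
  ...   | false | ih = ih

  length-filterᵇ-pair : ∀ {p : A → Bool} {a a′} → a ≢ a′ → (∀ x → p x ≡ true → x ≡ a ⊎ x ≡ a′) →
    ∀ xs → length (filterᵇ p xs) ≡ indicator (p a) * multiplicity _≟_ a xs + indicator (p a′) * multiplicity _≟_ a′ xs
  length-filterᵇ-pair {p} {a} {a′} a≢a′ cover [] = sym (cong₂ _+_ (*-zeroʳ (indicator (p a))) (*-zeroʳ (indicator (p a′))))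
  length-filterᵇ-pair {p} {a} {a′} a≢a′ cover (x ∷ xs) with x ≟ a | x ≟ a′
  ... | yes refl | yes refl = ⊥-elim (a≢a′ refl)
  ... | yes refl | no _ with p a | length-filterᵇ-pair a≢a′ cover xs
  ...   | true | ih = cong suc ih
  ...   | false | ih = ih
  length-filterᵇ-pair {p} {a} {a′} a≢a′ cover (x ∷ xs) | no _ | yes refl with p a′ | length-filterᵇ-pair a≢a′ cover xs
  ...   | true | ih = trans (cong suc ih) (sym (+-suc _ _))
  ...   | false | ih = ih
  length-filterᵇ-pair {p} {a} {a′} a≢a′ cover (x ∷ xs) | no x≢a | no x≢a′ with p x in px | length-filterᵇ-pair a≢a′ cover xs
  ...   | true | _ = ⊥-elim ([ x≢a , x≢a′ ]′ (cover x px))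
  ...   | false | ih = ih

multiplicity-words : ∀ w → all entry? w ≡ true →
                     multiplicity (≡-dec _≟_) w (words (1 ∷ 2 ∷ 3 ∷ []) (length w)) ≡ 1
multiplicity-words [] _ = refl
multiplicity-words (e ∷ w) entries =
  trans (multiplicity-concatMap-∷ _≟_ e w (words (1 ∷ 2 ∷ 3 ∷ []) (length w)) (1 ∷ 2 ∷ 3 ∷ []))
        (cong₂ _*_ (once e (∧-conicalˡ _ _ entries)) (multiplicity-words w (∧-conicalʳ (entry? e) _ entries)))
  where
  once : ∀ e → entry? e ≡ true → multiplicity _≟_ e (1 ∷ 2 ∷ 3 ∷ []) ≡ 1
  once 1 _ = refl
  once 2 _ = refl
  once 3 _ = refl
  once 0 ()
  once (suc (suc (suc (suc _)))) ()

multiplicity-fillings : ∀ T → all (all entry?) T ≡ true →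
                        multiplicity (≡-dec (≡-dec _≟_)) T (fillings (1 ∷ 2 ∷ 3 ∷ []) (shapeOf T)) ≡ 1
multiplicity-fillings [] _ = refl
multiplicity-fillings (r ∷ T) entries =
  trans (multiplicity-concatMap-∷ (≡-dec _≟_) r T (fillings (1 ∷ 2 ∷ 3 ∷ []) (shapeOf T)) (words (1 ∷ 2 ∷ 3 ∷ []) (length r)))
        (cong₂ _*_ (multiplicity-words r (∧-conicalˡ _ _ entries)) (multiplicity-fillings T (∧-conicalʳ (all entry? r) _ entries)))

filterᵇ-filterᵇ : ∀ {A : Set} (p q : A → Bool) xs → filterᵇ q (filterᵇ p xs) ≡ filterᵇ (λ x → p x ∧ q x) xs
filterᵇ-filterᵇ p q [] = refl
filterᵇ-filterᵇ p q (x ∷ xs) with p x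
... | false = filterᵇ-filterᵇ p q xs
... | true with q x
...   | true = cong (x ∷_) (filterᵇ-filterᵇ p q xs)
...   | false = filterᵇ-filterᵇ p q xs

private
  _≟ₜ_ : DecidableEquality (List (List ℕ))
  _≟ₜ_ = ≡-dec (≡-dec _≟_)

multiplicity-SSYT : ∀ μ n T → isSSYT3 μ n T ≡ true → multiplicity _≟ₜ_ T (fillings (1 ∷ 2 ∷ 3 ∷ []) μ) ≡ 1
multiplicity-SSYT μ n T h = subst (λ μ → multiplicity _≟ₜ_ T (fillings (1 ∷ 2 ∷ 3 ∷ []) μ) ≡ 1) shape
                                    (multiplicity-fillings T entries)
  where open Semistandard₃ (to (isSSYT3⇔ μ n T) h)

length-filterᵇ-SSYTs-single : ∀ {μ n T₀} → isSSYT3 μ n T₀ ≡ true → (∀ T → isSSYT3 μ n T ≡ true → T ≡ T₀) →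
  ∀ q → length (filterᵇ q (SSYTs μ n)) ≡ indicator (q T₀)
length-filterᵇ-SSYTs-single {μ} {n} {T₀} T₀-ssyt unique q = begin
  length (filterᵇ q (SSYTs μ n))
    ≡⟨ cong length (filterᵇ-filterᵇ (isSSYT3 μ n) q (fillings xs₁₂₃ μ)) ⟩
  length (filterᵇ (λ T → isSSYT3 μ n T ∧ q T) (fillings xs₁₂₃ μ))
    ≡⟨ length-filterᵇ-single _≟ₜ_ (λ T h → unique T (∧-conicalˡ _ _ h)) (fillings xs₁₂₃ μ) ⟩
  indicator (isSSYT3 μ n T₀ ∧ q T₀) * multiplicity _≟ₜ_ T₀ (fillings xs₁₂₃ μ)
    ≡⟨ cong₂ (λ s m → indicator (s ∧ q T₀) * m) T₀-ssyt (multiplicity-SSYT μ n T₀ T₀-ssyt) ⟩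
  indicator (q T₀) * 1
    ≡⟨ *-identityʳ (indicator (q T₀)) ⟩
  indicator (q T₀)
    ∎
  where
  open ≡-Reasoning
  xs₁₂₃ = 1 ∷ 2 ∷ 3 ∷ []

length-filterᵇ-SSYTs-pair : ∀ {μ n T₀ T₁} → isSSYT3 μ n T₀ ≡ true → isSSYT3 μ n T₁ ≡ true → T₀ ≢ T₁ →
  (∀ T → isSSYT3 μ n T ≡ true → T ≡ T₀ ⊎ T ≡ T₁) →
  ∀ q → length (filterᵇ q (SSYTs μ n)) ≡ indicator (q T₀) + indicator (q T₁)
length-filterᵇ-SSYTs-pair {μ} {n} {T₀} {T₁} T₀-ssyt T₁-ssyt T₀≢T₁ cover q = begin
  length (filterᵇ q (SSYTs μ n))
    ≡⟨ cong length (filterᵇ-filterᵇ (isSSYT3 μ n) q (fillings xs₁₂₃ μ)) ⟩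
  length (filterᵇ (λ T → isSSYT3 μ n T ∧ q T) (fillings xs₁₂₃ μ))
    ≡⟨ length-filterᵇ-pair _≟ₜ_ T₀≢T₁ (λ T h → cover T (∧-conicalˡ _ _ h)) (fillings xs₁₂₃ μ) ⟩
  indicator (isSSYT3 μ n T₀ ∧ q T₀) * multiplicity _≟ₜ_ T₀ (fillings xs₁₂₃ μ)
    + indicator (isSSYT3 μ n T₁ ∧ q T₁) * multiplicity _≟ₜ_ T₁ (fillings xs₁₂₃ μ)
    ≡⟨ cong₂ _+_ (cong₂ (λ s m → indicator (s ∧ q T₀) * m) T₀-ssyt (multiplicity-SSYT μ n T₀ T₀-ssyt))
                 (cong₂ (λ s m → indicator (s ∧ q T₁) * m) T₁-ssyt (multiplicity-SSYT μ n T₁ T₁-ssyt)) ⟩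
  indicator (q T₀) * 1 + indicator (q T₁) * 1
    ≡⟨ cong₂ _+_ (*-identityʳ (indicator (q T₀))) (*-identityʳ (indicator (q T₁))) ⟩
  indicator (q T₀) + indicator (q T₁)
    ∎
  where
  open ≡-Reasoning
  xs₁₂₃ = 1 ∷ 2 ∷ 3 ∷ []

-- The tableaux left after removing every copy of [123]

evenCore : ℕ → List (List ℕ)
evenCore b = tableau₂ (b + b) b 0 b (b + b)

evenShape : ℕ → List ℕ
evenShape b = b + b + b ∷ b + b + b ∷ []

evenCore-view : ∀ b → TwoRowView (b + b) (b + b + b) (evenCore b)
evenCore-view b = twoRowView b 0 b (b + b) refl refl refl (sym (+-assoc b b b)) (≤-reflexive (+-comm b (b + b)))

evenCore-IsSSYT : ∀ b → 1 ≤ b → IsSSYT (evenShape b) (b + b) (evenCore b)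
evenCore-IsSSYT b 1≤b = subst (λ μ → IsSSYT μ (b + b) (evenCore b)) shape
  (tableau₂-IsSSYT (b + b) b 0 b (b + b) refl refl (≤-reflexive (+-comm b (b + b))) (≤-trans 1≤b (m≤m+n b (b + b))))
  where
  shape : b + b + b + 0 ∷ b + (b + b) ∷ [] ≡ evenShape b
  shape = cong₂ (λ l₁ l₂ → l₁ ∷ l₂ ∷ []) (+-identityʳ (b + b + b)) (sym (+-assoc b b b))

evenCore-unique : ∀ b T → isSSYT3 (evenShape b) (b + b) T ≡ true → T ≡ evenCore b
evenCore-unique b T T-ssyt = views-agree w (evenCore-view b) (≤-antisym b′≤b b≤b′)
  where
  w : TwoRowView (b + b) (b + b + b) T
  w = twoRowView-of (to (isSSYT3⇔ (evenShape b) (b + b) T) T-ssyt)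
  open TwoRowView w using () renaming (b to b′)
  b≤b′ : b ≤ b′
  b≤b′ = +-cancelʳ-≤ (b + b) b b′ (subst (_≤ b′ + (b + b)) (+-assoc b b b) (proj₁ (view-bounds w)))
  fourfold : b + b + (b + b) ≡ b + (b + b + b)
  fourfold = solve (b ∷ [])
  b′≤b : b′ ≤ b
  b′≤b = +-cancelʳ-≤ (b + b + b) b′ b (subst (b′ + (b + b + b) ≤_) fourfold (proj₂ (view-bounds w)))

oddCore : ℕ → List (List ℕ)
oddCore b = tableau₂ (suc (b + b)) (suc b) 0 b (suc (b + b))

oddTwin : ℕ → List (List ℕ)
oddTwin b = tableau₂ (suc (b + b)) b 1 (suc b) (b + b)

oddShape : ℕ → List ℕ
oddShape b = 2 + (b + b + b) ∷ suc (b + b + b) ∷ []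

private
  oddCore-columns : ∀ b → b + suc (b + b) ≤ suc (b + b) + suc b
  oddCore-columns b = ≤-trans (n≤1+n (b + suc (b + b))) (≤-reflexive (columns b))
    where
    columns : ∀ b → suc (b + suc (b + b)) ≡ suc (b + b) + suc b
    columns = solve-∀

  oddCore-second : ∀ b → b + suc (b + b) ≡ suc (b + b + b)
  oddCore-second = solve-∀

  oddTwin-columns : ∀ b → suc b + (b + b) ≤ suc (b + b) + b
  oddTwin-columns b = ≤-reflexive (columns b)
    where
    columns : ∀ b → suc b + (b + b) ≡ suc (b + b) + b
    columns = solve-∀

oddCore-view : ∀ b → TwoRowView (suc (b + b)) (suc (b + b + b)) (oddCore b)
oddCore-view b = twoRowView (suc b) 0 b (suc (b + b)) refl refl refl (oddCore-second b) (oddCore-columns b)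

oddTwin-view : ∀ b → TwoRowView (suc (b + b)) (suc (b + b + b)) (oddTwin b)
oddTwin-view b = twoRowView b 1 (suc b) (b + b) refl (+-suc b b) refl (cong suc (sym (+-assoc b b b))) (oddTwin-columns b)

oddCore-IsSSYT : ∀ b → IsSSYT (oddShape b) (suc (b + b)) (oddCore b)
oddCore-IsSSYT b = subst (λ μ → IsSSYT μ (suc (b + b)) (oddCore b)) shape
  (tableau₂-IsSSYT (suc (b + b)) (suc b) 0 b (suc (b + b)) refl refl (oddCore-columns b) (≤-trans (s≤s z≤n) (m≤n+m _ b)))
  where
  first : ∀ b → suc (b + b) + suc b + 0 ≡ 2 + (b + b + b)
  first = solve-∀
  shape : suc (b + b) + suc b + 0 ∷ b + suc (b + b) ∷ [] ≡ oddShape b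
  shape = cong₂ (λ l₁ l₂ → l₁ ∷ l₂ ∷ []) (first b) (oddCore-second b)

oddTwin-IsSSYT : ∀ b → IsSSYT (oddShape b) (suc (b + b)) (oddTwin b)
oddTwin-IsSSYT b = subst (λ μ → IsSSYT μ (suc (b + b)) (oddTwin b)) shape
  (tableau₂-IsSSYT (suc (b + b)) b 1 (suc b) (b + b) (+-suc b b) refl (oddTwin-columns b) (s≤s z≤n))
  where
  first : ∀ b → suc (b + b) + b + 1 ≡ 2 + (b + b + b)
  first = solve-∀
  shape : suc (b + b) + b + 1 ∷ suc b + (b + b) ∷ [] ≡ oddShape b
  shape = cong₂ (λ l₁ l₂ → l₁ ∷ l₂ ∷ []) (first b) (cong suc (sym (+-assoc b b b)))

oddCore≢oddTwin : ∀ b → oddCore b ≢ oddTwin b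
oddCore≢oddTwin b core≡twin =
  1+n≢n (sym (trans (sym (countIn-row₂ 0 b (suc (b + b))))
                    (trans (cong (k₂ 2) core≡twin) (countIn-row₂ 0 (suc b) (b + b)))))

oddCore-cover : ∀ b T → isSSYT3 (oddShape b) (suc (b + b)) T ≡ true → T ≡ oddCore b ⊎ T ≡ oddTwin b
oddCore-cover b T T-ssyt = by-size (m≤n⇒m<n∨m≡n b′≤1+b)
  where
  w : TwoRowView (suc (b + b)) (suc (b + b + b)) T
  w = twoRowView-of (to (isSSYT3⇔ (oddShape b) (suc (b + b)) T) T-ssyt)
  open TwoRowView w using () renaming (b to b′)
  b≤b′ : b ≤ b′
  b≤b′ = +-cancelʳ-≤ (suc (b + b)) b b′ (subst (_≤ b′ + suc (b + b)) (sym (oddCore-second b)) (proj₁ (view-bounds w)))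
  twice : suc (b + b) + suc (b + b) ≡ suc b + suc (b + b + b)
  twice = solve (b ∷ [])
  b′≤1+b : b′ ≤ suc b
  b′≤1+b = +-cancelʳ-≤ (suc (b + b + b)) b′ (suc b) (subst (b′ + suc (b + b + b) ≤_) twice (proj₂ (view-bounds w)))
  by-size : b′ < suc b ⊎ b′ ≡ suc b → T ≡ oddCore b ⊎ T ≡ oddTwin b
  by-size (inj₁ b′≤b) = inj₁ (views-agree w (oddCore-view b) (≤-antisym (s≤s⁻¹ b′≤b) b≤b′))
  by-size (inj₂ b′≡1+b) = inj₂ (views-agree w (oddTwin-view b) b′≡1+b)

-- Residues 2 and 5 do not occur (j is 3b or 3b + 1), so their value is arbitrary.
predictedType : ℕ → SYT3
predictedType 0 = t123
predictedType 1 = t12∣3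
predictedType 3 = t1∣2∣3
predictedType 4 = t13∣2
predictedType _ = t123

thrice-%6 : ∀ b e → e < 3 → (b + (b + b) + e) % 6 ≡ (if isEven b then e else 3 + e)
thrice-%6 0 e e<3 = m<n⇒m%n≡m (≤-trans e<3 (m≤m+n 3 3))
thrice-%6 1 e e<3 = m<n⇒m%n≡m (+-monoʳ-< 3 e<3)
thrice-%6 (suc (suc b)) e e<3 = begin
  (suc (suc b) + (suc (suc b) + suc (suc b)) + e) % 6 ≡⟨ cong (_% 6) regroup ⟩
  (b + (b + b) + e + 6) % 6                           ≡⟨ [m+n]%n≡m%n (b + (b + b) + e) 6 ⟩
  (b + (b + b) + e) % 6                               ≡⟨ thrice-%6 b e e<3 ⟩
  (if isEven b then e else 3 + e)                     ≡⟨ cong (if_then e else 3 + e) (sym (not-involutive (isEven b))) ⟩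
  (if not (not (isEven b)) then e else 3 + e)         ∎
  where
  open ≡-Reasoning
  regroup : suc (suc b) + (suc (suc b) + suc (suc b)) + e ≡ b + (b + b) + e + 6
  regroup = solve (b ∷ e ∷ [])

resolve-single : ∀ {u} → indicator (u ==ᵗ t12∣3) ≡ indicator (u ==ᵗ t13∣2) →
                 (u ≡ t123 ⊎ u ≡ t12∣3 → u ≡ t123) × (u ≡ t13∣2 ⊎ u ≡ t1∣2∣3 → u ≡ t1∣2∣3)
resolve-single {t123} _ = (λ _ → refl) , λ { (inj₁ ()) ; (inj₂ ()) }
resolve-single {t1∣2∣3} _ = (λ { (inj₁ ()) ; (inj₂ ()) }) , λ _ → refl

resolve-pair-even : ∀ {u w} → indicator (u ==ᵗ t123) + indicator (w ==ᵗ t123) ≡ 0 → u ≡ t123 ⊎ u ≡ t12∣3 → u ≡ t12∣3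
resolve-pair-even _ (inj₂ u≡t12∣3) = u≡t12∣3
resolve-pair-even () (inj₁ refl)

resolve-pair-odd : ∀ {u w} → indicator (u ==ᵗ t123) + indicator (w ==ᵗ t123) ≡ 0 →
  indicator (u ==ᵗ t12∣3) + indicator (w ==ᵗ t12∣3) ≡ indicator (u ==ᵗ t13∣2) + indicator (w ==ᵗ t13∣2) →
  u ≡ t13∣2 ⊎ u ≡ t1∣2∣3 → w ≡ t123 ⊎ w ≡ t12∣3 → u ≡ t13∣2
resolve-pair-odd _ _ (inj₁ refl) (inj₂ refl) = refl
resolve-pair-odd () _ (inj₁ refl) (inj₁ refl)
resolve-pair-odd () _ (inj₂ refl) (inj₁ refl)
resolve-pair-odd _ () (inj₂ refl) (inj₂ refl)

indicator-==ᵗ : ∀ {u t} → indicator (u ==ᵗ t) + 0 ≡ 1 → u ≡ t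
indicator-==ᵗ {t123} {t123} _ = refl
indicator-==ᵗ {t12∣3} {t12∣3} _ = refl
indicator-==ᵗ {t13∣2} {t13∣2} _ = refl
indicator-==ᵗ {t1∣2∣3} {t1∣2∣3} _ = refl

module Attribution (type : List (List ℕ) → SYT3) (attribution : IsTypeAttribution type)
                   (rule₁ : RuleR1 type) (rule₂ : RuleR2 type) where

  type-strip : ∀ k {N X Y b c} → X + b ≡ N → Y + c ≡ N → b + c ≤ N + X → 1 ≤ b + c →
               type (tableau₂ (k + N) (k + X) (k + Y) b c) ≡ type (tableau₂ N X Y b c)
  type-strip zero _ _ _ _ = refl
  type-strip (suc k) {N} {X} {Y} {b} {c} X+b≡N Y+c≡N columns 1≤b+c = begin
    type (tableau₂ (suc k + N) (suc k + X) (suc k + Y) b c)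
      ≡⟨ cong (λ r → type (r ∷ row 0 b c ∷ [])) (sym (insertRow-row (k + N) (k + X) (k + Y))) ⟩
    type (join123 (tableau₂ (k + N) (k + X) (k + Y) b c))
      ≡⟨ rule₂ (k + N) (k + N + (k + X) + (k + Y) ∷ b + c ∷ []) _ padded-IsSSYT ⟩
    type (tableau₂ (k + N) (k + X) (k + Y) b c)
      ≡⟨ type-strip k X+b≡N Y+c≡N columns 1≤b+c ⟩
    type (tableau₂ N X Y b c)
      ∎
    where
    open ≡-Reasoning
    padded : ∀ {u v} → u + v ≡ N → k + u + v ≡ k + N
    padded {u} {v} u+v≡N = trans (+-assoc k u v) (cong (k +_) u+v≡N)
    padded-IsSSYT : IsSSYT (k + N + (k + X) + (k + Y) ∷ b + c ∷ []) (k + N) (tableau₂ (k + N) (k + X) (k + Y) b c)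
    padded-IsSSYT = tableau₂-IsSSYT (k + N) (k + X) (k + Y) b c (padded X+b≡N) (padded Y+c≡N)
                                    (≤-trans columns (+-mono-≤ (m≤n+m N k) (m≤n+m X k))) 1≤b+c

  type-oneRow : ∀ n → 1 ≤ n → type (row n n n ∷ []) ≡ t123
  type-oneRow (suc k) _ = trans (strip k) type-[123]
    where
    strip : ∀ k → type (row (suc k) (suc k) (suc k) ∷ []) ≡ type (row 1 1 1 ∷ [])
    strip zero = refl
    strip (suc k) = trans (cong (λ r → type (r ∷ [])) (sym (insertRow-row (suc k) (suc k) (suc k))))
                          (trans (rule₂ (suc k) (suc k + suc k + suc k ∷ []) _ (row-IsSSYT (s≤s z≤n))) (strip k))
    -- SSYTs (3 ∷ []) 1 evaluates to the single tableau [123], and pleth (3 ∷ []) 1 (3 ∷ []) to + 1.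
    type-[123] : type (row 1 1 1 ∷ []) ≡ t123
    type-[123] = indicator-==ᵗ (ℤₚ.+-injective (trans (cong ℤ.+_ (sym counted)) attributed))
      where
      counted = length-filterᵇ (λ T → type T ==ᵗ t123) (SSYTs (3 ∷ []) 1)
      attributed = attribution 1 (s≤s z≤n) (3 ∷ []) refl refl t123

  type-count₁ : ∀ {μ N T₀} → IsSSYT μ N T₀ → (∀ T → isSSYT3 μ N T ≡ true → T ≡ T₀) →
                ∀ t → ℤ.+ indicator (type T₀ ==ᵗ t) ≡ pleth (shapeSYT t) N μ
  type-count₁ {μ} {N} (1≤N , partition , size , T₀-ssyt) unique t =
    trans (cong ℤ.+_ (sym (length-filterᵇ-SSYTs-single T₀-ssyt unique (λ T → type T ==ᵗ t))))
          (attribution N 1≤N μ partition size t)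

  type-count₂ : ∀ {μ N T₀ T₁} → IsSSYT μ N T₀ → isSSYT3 μ N T₁ ≡ true → T₀ ≢ T₁ →
                (∀ T → isSSYT3 μ N T ≡ true → T ≡ T₀ ⊎ T ≡ T₁) →
                ∀ t → ℤ.+ (indicator (type T₀ ==ᵗ t) + indicator (type T₁ ==ᵗ t)) ≡ pleth (shapeSYT t) N μ
  type-count₂ {μ} {N} (1≤N , partition , size , T₀-ssyt) T₁-ssyt T₀≢T₁ cover t =
    trans (cong ℤ.+_ (sym (length-filterᵇ-SSYTs-pair T₀-ssyt T₁-ssyt T₀≢T₁ cover (λ T → type T ==ᵗ t))))
          (attribution N 1≤N μ partition size t)

  type-evenCore : ∀ b → 1 ≤ b → type (evenCore b) ≡ (if isEven b then t123 else t1∣2∣3)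
  type-evenCore b 1≤b = by-parity (isEven b) refl
    where
    ssyt : IsSSYT (evenShape b) (b + b) (evenCore b)
    ssyt = evenCore-IsSSYT b 1≤b
    count = type-count₁ {evenShape b} {b + b} {evenCore b} ssyt (evenCore-unique b)
    balanced : indicator (type (evenCore b) ==ᵗ t12∣3) ≡ indicator (type (evenCore b) ==ᵗ t13∣2)
    balanced = ℤₚ.+-injective (trans (count t12∣3) (sym (count t13∣2)))
    parity-core : isEven (k₂ 2 (evenCore b)) ≡ isEven b
    parity-core = cong isEven (countIn-row₂ 0 b (b + b))
    rule-core = rule₁ (b + b) (evenShape b) (evenCore b) ssyt
    by-parity : ∀ p → isEven b ≡ p → type (evenCore b) ≡ (if p then t123 else t1∣2∣3)
    by-parity true even = proj₁ (resolve-single balanced) (proj₁ rule-core (trans parity-core even))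
    by-parity false odd = proj₂ (resolve-single balanced) (proj₂ rule-core (trans parity-core odd))

  type-oddCore : ∀ b → type (oddCore b) ≡ (if isEven b then t12∣3 else t13∣2)
  type-oddCore b = by-parity (isEven b) refl
    where
    core : IsSSYT (oddShape b) (suc (b + b)) (oddCore b)
    core = oddCore-IsSSYT b
    twin : IsSSYT (oddShape b) (suc (b + b)) (oddTwin b)
    twin = oddTwin-IsSSYT b
    count = type-count₂ {oddShape b} {suc (b + b)} {oddCore b} {oddTwin b}
                        core (proj₂ (proj₂ (proj₂ twin))) (oddCore≢oddTwin b) (oddCore-cover b)
    no-t123 : indicator (type (oddCore b) ==ᵗ t123) + indicator (type (oddTwin b) ==ᵗ t123) ≡ 0
    no-t123 = ℤₚ.+-injective (trans (count t123) (pleth-3-vanishes b))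
    balanced : indicator (type (oddCore b) ==ᵗ t12∣3) + indicator (type (oddTwin b) ==ᵗ t12∣3)
             ≡ indicator (type (oddCore b) ==ᵗ t13∣2) + indicator (type (oddTwin b) ==ᵗ t13∣2)
    balanced = ℤₚ.+-injective (trans (count t12∣3) (sym (count t13∣2)))
    parity-core : isEven (k₂ 2 (oddCore b)) ≡ isEven b
    parity-core = cong isEven (countIn-row₂ 0 b (suc (b + b)))
    parity-twin : isEven (k₂ 2 (oddTwin b)) ≡ not (isEven b)
    parity-twin = cong isEven (countIn-row₂ 0 (suc b) (b + b))
    rule-core = rule₁ (suc (b + b)) (oddShape b) (oddCore b) core
    rule-twin = rule₁ (suc (b + b)) (oddShape b) (oddTwin b) twin
    by-parity : ∀ p → isEven b ≡ p → type (oddCore b) ≡ (if p then t12∣3 else t13∣2)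
    by-parity true even = resolve-pair-even no-t123 (proj₁ rule-core (trans parity-core even))
    by-parity false odd = resolve-pair-odd no-t123 balanced (proj₂ rule-core (trans parity-core odd))
                                           (proj₁ rule-twin (trans parity-twin (cong not odd)))

  type-twoRow-even : ∀ {n x y b c j} → x + b ≡ n → y + c ≡ n → b + c ≡ suc j → c ≡ b + b →
                     type (tableau₂ n x y b c) ≡ predictedType (suc j % 6)
  type-twoRow-even {x = x} {y} {b} {j = j} x+b≡n refl b+c≡j refl = begin
    type (tableau₂ (y + (b + b)) x y b (b + b))
      ≡⟨ cong₂ (λ x′ y′ → type (tableau₂ (y + (b + b)) x′ y′ b (b + b))) x≡y+b (sym (+-identityʳ y)) ⟩
    type (tableau₂ (y + (b + b)) (y + b) (y + 0) b (b + b))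
      ≡⟨ type-strip y refl refl (≤-reflexive (+-comm b (b + b))) (≤-trans 1≤b (m≤m+n b (b + b))) ⟩
    type (evenCore b)
      ≡⟨ type-evenCore b 1≤b ⟩
    (if isEven b then t123 else t1∣2∣3)
      ≡⟨ sym (if-float predictedType (isEven b)) ⟩
    predictedType (if isEven b then 0 else 3)
      ≡⟨ cong predictedType (sym (thrice-%6 b 0 (s≤s z≤n))) ⟩
    predictedType ((b + (b + b) + 0) % 6)
      ≡⟨ cong (λ j → predictedType (j % 6)) (trans (+-identityʳ _) b+c≡j) ⟩
    predictedType (suc j % 6)
      ∎
    where
    open ≡-Reasoning
    x≡y+b : x ≡ y + b
    x≡y+b = +-cancelʳ-≡ b x (y + b) (trans x+b≡n (sym (+-assoc y b b)))
    positive : ∀ {b} → b + (b + b) ≡ suc j → 1 ≤ b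
    positive {suc _} _ = s≤s z≤n
    1≤b : 1 ≤ b
    1≤b = positive b+c≡j

  type-twoRow-odd : ∀ {n x y b c j} → x + b ≡ n → y + c ≡ n → b + c ≡ suc j → c ≡ suc (b + b) →
                    type (tableau₂ n x y b c) ≡ predictedType (suc j % 6)
  type-twoRow-odd {x = x} {y} {b} {j = j} x+b≡n refl b+c≡j refl = begin
    type (tableau₂ (y + suc (b + b)) x y b (suc (b + b)))
      ≡⟨ cong₂ (λ x′ y′ → type (tableau₂ (y + suc (b + b)) x′ y′ b (suc (b + b)))) x≡y+1+b (sym (+-identityʳ y)) ⟩
    type (tableau₂ (y + suc (b + b)) (y + suc b) (y + 0) b (suc (b + b)))
      ≡⟨ type-strip y refl refl columns (≤-trans (s≤s z≤n) (m≤n+m (suc (b + b)) b)) ⟩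
    type (oddCore b)
      ≡⟨ type-oddCore b ⟩
    (if isEven b then t12∣3 else t13∣2)
      ≡⟨ sym (if-float predictedType (isEven b)) ⟩
    predictedType (if isEven b then 1 else 4)
      ≡⟨ cong predictedType (sym (thrice-%6 b 1 (s≤s (s≤s z≤n)))) ⟩
    predictedType ((b + (b + b) + 1) % 6)
      ≡⟨ cong (λ j → predictedType (j % 6)) (trans (thrice+1 b) b+c≡j) ⟩
    predictedType (suc j % 6)
      ∎
    where
    open ≡-Reasoning
    x≡y+1+b : x ≡ y + suc b
    x≡y+1+b = +-cancelʳ-≡ b x (y + suc b) (trans x+b≡n (sym (+-assoc y (suc b) b)))
    columns : b + suc (b + b) ≤ suc (b + b) + suc b
    columns = ≤-trans (n≤1+n _) (≤-reflexive (columns-eq b))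
      where
      columns-eq : ∀ b → suc (b + suc (b + b)) ≡ suc (b + b) + suc b
      columns-eq = solve-∀
    thrice+1 : ∀ b → b + (b + b) + 1 ≡ b + suc (b + b)
    thrice+1 = solve-∀

  type-twoRow : ∀ {n j T} → TwoRowView n (suc j) T → k₂ 2 T ≡ k₂ 3 T / 2 → type T ≡ predictedType (suc j % 6)
  type-twoRow {n} {j} (twoRowView x y b c refl x+b≡n y+c≡n b+c≡j _) halves = by-remainder (c % 2) (m%n<n c 2) c≡
    where
    b≡c/2 : b ≡ c / 2
    b≡c/2 = trans (sym (countIn-row₂ 0 b c)) (trans halves (cong (_/ 2) (countIn-row₃ 0 b c)))
    c≡ : c ≡ c % 2 + b * 2
    c≡ = trans (m≡m%n+[m/n]*n c 2) (cong (λ q → c % 2 + q * 2) (sym b≡c/2))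
    by-remainder : ∀ e → e < 2 → c ≡ e + b * 2 → type (tableau₂ n x y b c) ≡ predictedType (suc j % 6)
    by-remainder 0 _ c≡2b = type-twoRow-even x+b≡n y+c≡n b+c≡j (trans c≡2b (double b))
      where
      double : ∀ b → 0 + b * 2 ≡ b + b
      double = solve-∀
    by-remainder 1 _ c≡2b+1 = type-twoRow-odd x+b≡n y+c≡n b+c≡j (trans c≡2b+1 (double+1 b))
      where
      double+1 : ∀ b → 1 + b * 2 ≡ suc (b + b)
      double+1 = solve-∀
    by-remainder (suc (suc _)) (s≤s (s≤s ())) _

  type-predicted : ∀ n j T → 1 ≤ n → isSSYT3 (twoRow (3 * n ∸ j) j) n T ≡ true → k₂ 2 T ≡ k₂ 3 T / 2 →
                   type T ≡ predictedType (j % 6)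
  type-predicted n zero T 1≤n T-ssyt _ =
    trans (cong type (oneRow-of (to (isSSYT3⇔ _ n T) T-ssyt))) (type-oneRow n 1≤n)
  type-predicted n (suc j) T _ T-ssyt halves = type-twoRow (twoRowView-of (to (isSSYT3⇔ _ n T) T-ssyt)) halves

mainTheorem6 : (type : List (List ℕ) → SYT3) → IsTypeAttribution type → RuleR1 type → RuleR2 type →
    ∀ (n j : ℕ) (T : List (List ℕ)) → 1 ≤ n → j ≤ (3 * n) / 2 →
    isSSYT3 (twoRow (3 * n ∸ j) j) n T ≡ true →
    k₂ 2 T ≡ k₂ 3 T / 2 →
    ((j % 6 ≡ 0 → type T ≡ t123) × (j % 6 ≡ 1 → type T ≡ t12∣3) ×
    (j % 6 ≡ 3 → type T ≡ t1∣2∣3) × (j % 6 ≡ 4 → type T ≡ t13∣2))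
mainTheorem6 type attribution rule₁ rule₂ n j T 1≤n _ T-ssyt halves = predicted , predicted , predicted , predicted
  where
  predicted : ∀ {r} → j % 6 ≡ r → type T ≡ predictedType r
  predicted refl = Attribution.type-predicted type attribution rule₁ rule₂ n j T 1≤n T-ssyt halves
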